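{- Let $\alpha\in\mathbb{R}$, $m\in\mathbb{N}$, and let $(u_n)_{n\ge1}$ be defined by $u_1=1$, $u_n=(-n+2+\alpha)u_{n-1}+m\sum_{j=1}^{n-1}u_ju_{n-j}$ ($n\ge2$). Let $\xi_1,\dots,\xi_m$ be the zeros (with multiplicity) of the Laguerre polynomial $L_m^{(\alpha)}(x)=\sum_{j=0}^m\binom{m+\alpha}{m-j}\frac{(-x)^j}{j!}$. Then for every $n\ge1$ $$u_n=\frac1m\sum_{i=1}^m\xi_i^{\,n-1}=\frac1m\operatorname{tr}\big[T^{n-1}\big]$$ (with $0^0=1$, $T^0$ the identity), where $T$ is the $m\times m$ tridiagonal matrix with diagonal entries $T_{jj}=2j-1+\alpha$ ($j=1,\dots,m$), superdiagonal entries $T_{j,j+1}=1$ and subdiagonal entries $T_{j+1,j}=j(j+\alpha)$ ($j=1,\dots,m-1$), whose characteristic polynomial is the monic Laguerre polynomial $(-1)^m m!\,L_m^{(\alpha)}(x)$.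
   Context: $\binom{m+\alpha}{m-j}$ is the generalized binomial coefficient. -}

module Defs where

open import Level using (Level)
open import Algebra.Bundles using (CommutativeRing)
open import Data.Nat as ℕ using (ℕ; zero; suc; _∸_)
open import Data.Nat.Combinatorics using (_C_)
open import Data.Fin as Fin using (Fin; toℕ; opposite)
open import Data.Vec.Functional using (Vector; _∷_)
open import Data.Bool using (if_then_else_)
open import Relation.Nullary using (does)

module _ {c ℓ : Level} (R : CommutativeRing c ℓ) where
  open CommutativeRing R hiding (zero)

  natR : ℕ → Carrier
  natR zero    = 0#
  natR (suc n) = 1# + natR n

  powR : Carrier → ℕ → Carrier
  powR x zero    = 1#
  powR x (suc n) = x * powR x n

  sumFin : (n : ℕ) → (Fin n → Carrier) → Carrier
  sumFin zero    f = 0#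
  sumFin (suc n) f = f Fin.zero + sumFin n (λ i → f (Fin.suc i))

  -- uTable α m k i = u_{k+1-i}   (i.e. the values u_{k+1}, u_k, …, u_1)
  uTable : Carrier → ℕ → (k : ℕ) → Vector Carrier (suc k)
  uTable α m zero    = λ _ → 1#
  uTable α m (suc k) =
    ((α - natR k) * prev Fin.zero
      + natR m * sumFin (suc k) (λ i → prev i * prev (opposite i)))
    ∷ prev
    where
    prev : Vector Carrier (suc k)
    prev = uTable α m k

  -- u α m n = u_n for n ≥ 1 (the value at n = 0 is an unused dummy 0)
  u : Carrier → ℕ → ℕ → Carrier
  u α m zero    = 0#
  u α m (suc k) = uTable α m k Fin.zero

  -- Polynomials are represented by their coefficient functions ℕ → R
  -- (coefficient of x^j).

  -- coefficients of ∏_{i=1}^{k} (x - ξ_i)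
  rootPoly : (k : ℕ) → (Fin k → Carrier) → ℕ → Carrier
  rootPoly zero    ξ zero    = 1#
  rootPoly zero    ξ (suc j) = 0#
  rootPoly (suc k) ξ zero    = - (ξ Fin.zero * rootPoly k (λ i → ξ (Fin.suc i)) zero)
  rootPoly (suc k) ξ (suc j) =
    rootPoly k (λ i → ξ (Fin.suc i)) j - ξ Fin.zero * rootPoly k (λ i → ξ (Fin.suc i)) (suc j)

  -- falling product a (a-1) ⋯ (a-r+1)  (numerator of the generalized binomial)
  falling : Carrier → ℕ → Carrier
  falling a zero    = 1#
  falling a (suc r) = falling a r * (a - natR r)

  -- Coefficient of x^j in the monic Laguerre polynomial (-1)^m m! L_m^{(α)}(x),
  -- where L_m^{(α)}(x) = Σ_{j=0}^m binom(m+α, m-j) (-x)^j / j!.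
  -- Since binom(m+α, m-j) = falling (m+α) (m-j) / (m-j)!, the coefficient
  -- (-1)^m m! (-1)^j binom(m+α,m-j) / j!  equals
  -- (-1)^(m-j) · C(m,j) · falling (m+α) (m-j)   (and 0 for j > m).
  monicLaguerre : ℕ → Carrier → ℕ → Carrier
  monicLaguerre m α j =
    if does (j ℕ.≤? m)
    then powR (- 1#) (m ∸ j) * (natR (m C j) * falling (natR m + α) (m ∸ j))
    else 0#

  Mat : ℕ → Set c
  Mat m = Fin m → Fin m → Carrier

  idMat : (m : ℕ) → Mat m
  idMat m i j = if does (toℕ i ℕ.≟ toℕ j) then 1# else 0#

  mulMat : (m : ℕ) → Mat m → Mat m → Mat m
  mulMat m A B i j = sumFin m (λ k → A i k * B k j)

  powMat : (m : ℕ) → Mat m → ℕ → Mat m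
  powMat m A zero    = idMat m
  powMat m A (suc n) = mulMat m A (powMat m A n)

  trace : (m : ℕ) → Mat m → Carrier
  trace m A = sumFin m (λ i → A i i)

  -- The tridiagonal matrix T (0-based indices i, j; the paper's index is i+1):
  --   T_{jj} = 2j-1+α,  T_{j,j+1} = 1,  T_{j+1,j} = j(j+α).
  Tmat : Carrier → (m : ℕ) → Mat m
  Tmat α m i j =
    if does (toℕ i ℕ.≟ toℕ j) then natR (2 ℕ.* toℕ i ℕ.+ 1) + α
    else if does (suc (toℕ i) ℕ.≟ toℕ j) then 1#
    else if does (toℕ i ℕ.≟ suc (toℕ j)) then natR (suc (toℕ j)) * (natR (suc (toℕ j)) + α)
    else 0#

module Submission where

-- Let Q(t) = ∏ᵢ (1 - ξᵢ t) be the reciprocal of the monic Laguerre polynomial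
-- and P(t) = Σₙ pₙ tⁿ the series of power sums pₙ = Σᵢ ξᵢⁿ. Newton's
-- identities read Q P = m Q - t Q′. The Laguerre differential equation gives
-- the coefficients of Q a first-order recurrence; eliminating Q turns
-- Newton's identities into a Riccati equation for P, whose coefficientwise
-- form is the recurrence of m uₙ₊₁, so pₙ = m uₙ₊₁.
-- For the trace, x acts on the Laguerre polynomials of degree < m (modulo the
-- m-th one) by the tridiagonal matrix T, through their three-term recurrence,
-- and on the partial products ∏_{l<j} (x - ξₗ) by an upper bidiagonal matrix
-- with diagonal ξ. Both families are monic bases, so the transition matrix
-- conjugates T into the bidiagonal matrix and tr Tᵏ = Σᵢ ξᵢᵏ.
-- The argument is purely algebraic and works over any commutative ring.

open import Defs
open import Level using (Level)
open import Algebra.Bundles using (CommutativeRing)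
open import Data.Nat as ℕ using (ℕ; zero; suc; _≤_; _<_; _∸_; z≤n; s≤s)
import Data.Nat.Properties as ℕP
open import Data.Fin as Fin using (Fin; toℕ; fromℕ<; opposite)
open import Data.Product using (Σ; _×_; _,_; proj₁; proj₂)
open import Data.Sum using (inj₁; inj₂)
open import Data.Empty using (⊥-elim)
open import Data.Bool using (if_then_else_)
open import Relation.Nullary using (yes; no; does)
open import Relation.Binary.PropositionalEquality as P using (_≡_; _≢_)

module BinomialAbsorption where
  open import Data.Nat using (_*_; _+_)
  open import Data.Nat.Properties
  open import Data.Nat.Combinatorics
  open import Relation.Binary.PropositionalEquality
  open ≡-Reasoning

  [1+k]*[1+n]C[1+k]≡[1+n]*nCk : ∀ n k → suc k * (suc n C suc k) ≡ suc n * (n C k)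
  [1+k]*[1+n]C[1+k]≡[1+n]*nCk zero    zero    = refl
  [1+k]*[1+n]C[1+k]≡[1+n]*nCk zero    (suc k) = *-zeroʳ (suc (suc k))
  [1+k]*[1+n]C[1+k]≡[1+n]*nCk (suc n) zero    =
    trans (+-identityʳ _) (trans (nC1≡n (suc (suc n))) (sym (*-identityʳ _)))
  [1+k]*[1+n]C[1+k]≡[1+n]*nCk (suc n) (suc k) = begin
    suc (suc k) * (suc (suc n) C suc (suc k))
      ≡⟨ cong (suc (suc k) *_) (sym (nCk+nC[k+1]≡[n+1]C[k+1] (suc n) (suc k))) ⟩
    suc (suc k) * (x + y)              ≡⟨ *-distribˡ-+ (suc (suc k)) x y ⟩
    (x + suc k * x) + suc (suc k) * y  ≡⟨ cong₂ (λ p q → (x + p) + q)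
                                            ([1+k]*[1+n]C[1+k]≡[1+n]*nCk n k)
                                            ([1+k]*[1+n]C[1+k]≡[1+n]*nCk n (suc k)) ⟩
    (x + suc n * a) + suc n * b        ≡⟨ +-assoc x _ _ ⟩
    x + (suc n * a + suc n * b)        ≡⟨ cong (x +_) (sym (*-distribˡ-+ (suc n) a b)) ⟩
    x + suc n * (a + b)                ≡⟨ cong (λ z → x + suc n * z) (nCk+nC[k+1]≡[n+1]C[k+1] n k) ⟩
    suc (suc n) * x                    ∎
    where
    x = suc n C suc k
    y = suc n C suc (suc k)
    a = n C k
    b = n C suc k

  [1+n∸k]*[1+n]Ck≡[1+n]*nCk : ∀ n k → k ≤ n → (suc n ∸ k) * (suc n C k) ≡ suc n * (n C k)
  [1+n∸k]*[1+n]Ck≡[1+n]*nCk n k k≤n = begin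
    (suc n ∸ k) * (suc n C k)              ≡⟨ cong₂ _*_ 1+n∸k (nCk≡nC[n∸k] (m≤n⇒m≤1+n k≤n)) ⟩
    suc (n ∸ k) * (suc n C (suc n ∸ k))    ≡⟨ cong (λ z → suc (n ∸ k) * (suc n C z)) 1+n∸k ⟩
    suc (n ∸ k) * (suc n C suc (n ∸ k))    ≡⟨ [1+k]*[1+n]C[1+k]≡[1+n]*nCk n (n ∸ k) ⟩
    suc n * (n C (n ∸ k))                  ≡⟨ cong (suc n *_) (sym (nCk≡nC[n∸k] k≤n)) ⟩
    suc n * (n C k)                        ∎
    where
    1+n∸k : suc n ∸ k ≡ suc (n ∸ k)
    1+n∸k = +-∸-assoc 1 k≤n

  [n∸k]*nCk≡[1+k]*nC[1+k] : ∀ n k → k < n → (n ∸ k) * (n C k) ≡ suc k * (n C suc k)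
  [n∸k]*nCk≡[1+k]*nC[1+k] (suc n) k (s≤s k≤n) =
    trans ([1+n∸k]*[1+n]Ck≡[1+n]*nCk n k k≤n) (sym ([1+k]*[1+n]C[1+k]≡[1+n]*nCk n k))

module RingArithmetic {c ℓ : Level} (R : CommutativeRing c ℓ) where
  open import Data.Maybe using (Maybe; nothing; just)
  open import Data.Integer as ℤ using (ℤ; +_; -[1+_]; _⊖_; sign; ∣_∣; _◃_)
  import Data.Integer.Properties as ℤP
  open import Data.Sign as Sign using (Sign)
  import Algebra.Solver.Ring as Solver
  open import Algebra.Solver.Ring.AlmostCommutativeRing
    using (fromCommutativeRing; _-Raw-AlmostCommutative⟶_)

  open CommutativeRing R hiding (zero)
  open import Relation.Binary.Reasoning.Setoid setoid
  open import Algebra.Properties.Ring ring public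
    using (-‿distribˡ-*; -‿involutive; -0#≈0#; -‿+-comm; -1*x≈-x)
  open import Algebra.Properties.CommutativeSemigroup +-commutativeSemigroup public
    using () renaming (interchange to +-interchange)
  open import Algebra.Properties.CommutativeSemigroup *-commutativeSemigroup public
    using () renaming (interchange to *-interchange; x∙yz≈y∙xz to x*yz≈y*xz; x∙yz≈yx∙z to x*yz≈yx*z)

  ⟨_⟩ : ℕ → Carrier
  ⟨_⟩ = natR R

  ⟨⟩-cong : ∀ {a b} → a ≡ b → ⟨ a ⟩ ≈ ⟨ b ⟩
  ⟨⟩-cong P.refl = refl

  ⟨⟩-+ : ∀ a b → ⟨ a ℕ.+ b ⟩ ≈ ⟨ a ⟩ + ⟨ b ⟩
  ⟨⟩-+ zero    b = sym (+-identityˡ _)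
  ⟨⟩-+ (suc a) b = trans (+-congˡ (⟨⟩-+ a b)) (sym (+-assoc _ _ _))

  ⟨⟩-* : ∀ a b → ⟨ a ℕ.* b ⟩ ≈ ⟨ a ⟩ * ⟨ b ⟩
  ⟨⟩-* zero    b = sym (zeroˡ _)
  ⟨⟩-* (suc a) b = trans (⟨⟩-+ b (a ℕ.* b))
    (trans (+-cong (sym (*-identityˡ _)) (⟨⟩-* a b)) (sym (distribʳ _ _ _)))

  powR-cong : ∀ {a b} k → a ≈ b → powR R a k ≈ powR R b k
  powR-cong zero    a≈b = refl
  powR-cong (suc k) a≈b = *-cong a≈b (powR-cong k a≈b)

  private
    intR : ℤ → Carrier
    intR (+ n)     = ⟨ n ⟩
    intR -[1+ n ]  = - ⟨ suc n ⟩

    signR : Sign → Carrier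
    signR Sign.+ = 1#
    signR Sign.- = - 1#

    intR-⊖ : ∀ a b → intR (a ⊖ b) ≈ ⟨ a ⟩ - ⟨ b ⟩
    intR-⊖ zero    zero    = sym (trans (+-congˡ -0#≈0#) (+-identityʳ _))
    intR-⊖ (suc a) zero    rewrite ℤP.⊖-≥ {suc a} {zero} ℕ.z≤n = sym (trans (+-congˡ -0#≈0#) (+-identityʳ _))
    intR-⊖ zero    (suc b) rewrite ℤP.⊖-≤ {zero} {suc b} ℕ.z≤n = sym (+-identityˡ _)
    intR-⊖ (suc a) (suc b) rewrite ℤP.[1+m]⊖[1+n]≡m⊖n a b = begin
      intR (a ⊖ b)                                ≈⟨ intR-⊖ a b ⟩
      ⟨ a ⟩ - ⟨ b ⟩                               ≈⟨ sym (+-identityˡ _) ⟩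
      0# + (⟨ a ⟩ - ⟨ b ⟩)                        ≈⟨ +-congʳ (sym (-‿inverseʳ 1#)) ⟩
      (1# - 1#) + (⟨ a ⟩ - ⟨ b ⟩)                 ≈⟨ +-interchange _ _ _ _ ⟩
      (1# + ⟨ a ⟩) + (- 1# - ⟨ b ⟩)               ≈⟨ +-congˡ (-‿+-comm 1# ⟨ b ⟩) ⟩
      (1# + ⟨ a ⟩) - (1# + ⟨ b ⟩)                 ∎

    intR-+ : ∀ i j → intR (i ℤ.+ j) ≈ intR i + intR j
    intR-+ (+ a)     (+ b)     = ⟨⟩-+ a b
    intR-+ (+ a)     -[1+ b ]  = intR-⊖ a (suc b)
    intR-+ -[1+ a ]  (+ b)     = trans (intR-⊖ b (suc a)) (+-comm _ _)
    intR-+ -[1+ a ]  -[1+ b ]  = begin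
      - ⟨ suc (suc (a ℕ.+ b)) ⟩               ≈⟨ -‿cong (⟨⟩-cong (P.sym (ℕP.+-suc (suc a) b))) ⟩
      - ⟨ suc a ℕ.+ suc b ⟩                   ≈⟨ -‿cong (⟨⟩-+ (suc a) (suc b)) ⟩
      - (⟨ suc a ⟩ + ⟨ suc b ⟩)               ≈⟨ sym (-‿+-comm _ _) ⟩
      - ⟨ suc a ⟩ - ⟨ suc b ⟩                 ∎

    intR-neg : ∀ i → intR (ℤ.- i) ≈ - intR i
    intR-neg (+ zero)  = sym -0#≈0#
    intR-neg (+ suc n) = refl
    intR-neg -[1+ n ]  = sym (-‿involutive _)

    intR-◃ : ∀ s n → intR (s ◃ n) ≈ signR s * ⟨ n ⟩
    intR-◃ s        zero    = sym (zeroʳ _)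
    intR-◃ Sign.+   (suc n) = sym (*-identityˡ _)
    intR-◃ Sign.-   (suc n) = sym (-1*x≈-x _)

    intR-sign-abs : ∀ i → intR i ≈ signR (sign i) * ⟨ ∣ i ∣ ⟩
    intR-sign-abs (+ n)     = sym (*-identityˡ _)
    intR-sign-abs -[1+ n ]  = sym (-1*x≈-x _)

    signR-* : ∀ s t → signR (s Sign.* t) ≈ signR s * signR t
    signR-* Sign.- Sign.- = sym (trans (-1*x≈-x (- 1#)) (-‿involutive 1#))
    signR-* Sign.- Sign.+ = sym (*-identityʳ _)
    signR-* Sign.+ Sign.- = sym (*-identityˡ _)
    signR-* Sign.+ Sign.+ = sym (*-identityˡ _)

    intR-* : ∀ i j → intR (i ℤ.* j) ≈ intR i * intR j
    intR-* i j = begin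
      intR (sign i Sign.* sign j ◃ ∣ i ∣ ℕ.* ∣ j ∣)
        ≈⟨ intR-◃ (sign i Sign.* sign j) (∣ i ∣ ℕ.* ∣ j ∣) ⟩
      signR (sign i Sign.* sign j) * ⟨ ∣ i ∣ ℕ.* ∣ j ∣ ⟩
        ≈⟨ *-cong (signR-* (sign i) (sign j)) (⟨⟩-* ∣ i ∣ ∣ j ∣) ⟩
      (signR (sign i) * signR (sign j)) * (⟨ ∣ i ∣ ⟩ * ⟨ ∣ j ∣ ⟩)
        ≈⟨ *-interchange _ _ _ _ ⟩
      (signR (sign i) * ⟨ ∣ i ∣ ⟩) * (signR (sign j) * ⟨ ∣ j ∣ ⟩)
        ≈⟨ sym (*-cong (intR-sign-abs i) (intR-sign-abs j)) ⟩
      intR i * intR j ∎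

    -- The solver's constants must evaluate to 0# and 1# on the nose, so 1 is
    -- sent to 1# rather than to ⟨ 1 ⟩ = 1# + 0#.
    natConst : ℕ → Carrier
    natConst zero          = 0#
    natConst (suc zero)    = 1#
    natConst (suc (suc n)) = 1# + natConst (suc n)

    natConst≈⟨⟩ : ∀ n → natConst n ≈ ⟨ n ⟩
    natConst≈⟨⟩ zero          = refl
    natConst≈⟨⟩ (suc zero)    = sym (+-identityʳ _)
    natConst≈⟨⟩ (suc (suc n)) = +-congˡ (natConst≈⟨⟩ (suc n))

    intConst : ℤ → Carrier
    intConst (+ n)    = natConst n
    intConst -[1+ n ] = - natConst (suc n)

    intConst≈intR : ∀ i → intConst i ≈ intR i
    intConst≈intR (+ n)    = natConst≈⟨⟩ n
    intConst≈intR -[1+ n ] = -‿cong (natConst≈⟨⟩ (suc n))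

    homomorphism : ℤ.+-*-rawRing -Raw-AlmostCommutative⟶ fromCommutativeRing R
    homomorphism = record
      { ⟦_⟧    = intConst
      ; +-homo = λ i j → trans (intConst≈intR (i ℤ.+ j))
          (trans (intR-+ i j) (sym (+-cong (intConst≈intR i) (intConst≈intR j))))
      ; *-homo = λ i j → trans (intConst≈intR (i ℤ.* j))
          (trans (intR-* i j) (sym (*-cong (intConst≈intR i) (intConst≈intR j))))
      ; -‿homo = λ i → trans (intConst≈intR (ℤ.- i))
          (trans (intR-neg i) (sym (-‿cong (intConst≈intR i))))
      ; 0-homo = refl
      ; 1-homo = refl
      }

    coefficientsEqual : (a b : ℤ) → Maybe (intConst a ≈ intConst b)
    coefficientsEqual a b with a ℤ.≟ b
    ... | yes P.refl = just refl
    ... | no _       = nothing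

  open Solver ℤ.+-*-rawRing (fromCommutativeRing R) homomorphism coefficientsEqual public
    using (solve; _:=_; _:+_; _:*_; _:-_; :-_; con; Polynomial)

  :0 :1 : ∀ {n} → Polynomial n
  :0 = con (+ 0)
  :1 = con (+ 1)

module PowerSeries {c ℓ : Level} (R : CommutativeRing c ℓ) where
  open import Relation.Binary.Bundles using (Setoid)
  import Relation.Binary.Reasoning.Setoid as SetoidReasoning
  open CommutativeRing R hiding (zero)
  open RingArithmetic R
  open import Relation.Binary.Reasoning.Setoid setoid

  Series : Set c
  Series = ℕ → Carrier

  infix 4 _≋_
  _≋_ : Series → Series → Set ℓ
  A ≋ B = ∀ n → A n ≈ B n

  ≋-refl : ∀ {A} → A ≋ A
  ≋-refl n = refl

  ≋-sym : ∀ {A B} → A ≋ B → B ≋ A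
  ≋-sym p n = sym (p n)

  ≋-trans : ∀ {A B C} → A ≋ B → B ≋ C → A ≋ C
  ≋-trans p q n = trans (p n) (q n)

  ≋-setoid : Setoid c ℓ
  ≋-setoid = record
    { Carrier = Series ; _≈_ = _≋_
    ; isEquivalence = record { refl = ≋-refl ; sym = ≋-sym ; trans = ≋-trans } }

  module ≋-Reasoning = SetoidReasoning ≋-setoid

  infixl 6 _⊕_ _⊖_
  infixl 7 _⊙_ _⋆_

  _⊕_ _⊖_ : Series → Series → Series
  (A ⊕ B) n = A n + B n
  (A ⊖ B) n = A n - B n

  _⋆_ : Carrier → Series → Series
  (k ⋆ A) n = k * A n

  𝟘 𝟙 : Series
  𝟘 n = 0#
  𝟙 zero    = 1#
  𝟙 (suc n) = 0#

  tail : Series → Series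
  tail A n = A (suc n)

  shift : Series → Series
  shift A zero    = 0#
  shift A (suc n) = A n

  θ : Series → Series
  θ A n = ⟨ n ⟩ * A n

  _⊙_ : Series → Series → Series
  (A ⊙ B) zero    = A 0 * B 0
  (A ⊙ B) (suc n) = A 0 * B (suc n) + (tail A ⊙ B) n

  ⊕-cong : ∀ {A A′ B B′} → A ≋ A′ → B ≋ B′ → A ⊕ B ≋ A′ ⊕ B′
  ⊕-cong p q n = +-cong (p n) (q n)

  ⊖-cong : ∀ {A A′ B B′} → A ≋ A′ → B ≋ B′ → A ⊖ B ≋ A′ ⊖ B′
  ⊖-cong p q n = +-cong (p n) (-‿cong (q n))

  ⋆-cong : ∀ k {A B} → A ≋ B → k ⋆ A ≋ k ⋆ B
  ⋆-cong k p n = *-congˡ (p n)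

  shift-cong : ∀ {A B} → A ≋ B → shift A ≋ shift B
  shift-cong p zero    = refl
  shift-cong p (suc n) = p n

  ⊙-cong : ∀ {A A′ B B′} → A ≋ A′ → B ≋ B′ → A ⊙ B ≋ A′ ⊙ B′
  ⊙-cong p q zero    = *-cong (p 0) (q 0)
  ⊙-cong p q (suc n) = +-cong (*-cong (p 0) (q (suc n))) (⊙-cong (λ k → p (suc k)) q n)

  ⊙-distribʳ-⊕ : ∀ A A′ B → (A ⊕ A′) ⊙ B ≋ A ⊙ B ⊕ A′ ⊙ B
  ⊙-distribʳ-⊕ A A′ B zero    = distribʳ _ _ _
  ⊙-distribʳ-⊕ A A′ B (suc n) =
    trans (+-cong (distribʳ _ _ _) (⊙-distribʳ-⊕ _ _ B n)) (+-interchange _ _ _ _)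

  ⊙-distribˡ-⊕ : ∀ A B B′ → A ⊙ (B ⊕ B′) ≋ A ⊙ B ⊕ A ⊙ B′
  ⊙-distribˡ-⊕ A B B′ zero    = distribˡ _ _ _
  ⊙-distribˡ-⊕ A B B′ (suc n) =
    trans (+-cong (distribˡ _ _ _) (⊙-distribˡ-⊕ _ B B′ n)) (+-interchange _ _ _ _)

  private
    -‿+-interchange : ∀ a b x y → (a - b) + (x - y) ≈ (a + x) - (b + y)
    -‿+-interchange = solve 4 (λ a b x y → (a :- b) :+ (x :- y) := (a :+ x) :- (b :+ y)) refl

    distribʳ-- : ∀ a b x → (a - b) * x ≈ a * x - b * x
    distribʳ-- = solve 3 (λ a b x → (a :- b) :* x := a :* x :- b :* x) refl

    distribˡ-- : ∀ a b x → x * (a - b) ≈ x * a - x * b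
    distribˡ-- = solve 3 (λ a b x → x :* (a :- b) := x :* a :- x :* b) refl

  ⊙-distribʳ-⊖ : ∀ A A′ B → (A ⊖ A′) ⊙ B ≋ A ⊙ B ⊖ A′ ⊙ B
  ⊙-distribʳ-⊖ A A′ B zero    = distribʳ-- _ _ _
  ⊙-distribʳ-⊖ A A′ B (suc n) =
    trans (+-cong (distribʳ-- _ _ _) (⊙-distribʳ-⊖ _ _ B n)) (-‿+-interchange _ _ _ _)

  ⊙-distribˡ-⊖ : ∀ A B B′ → A ⊙ (B ⊖ B′) ≋ A ⊙ B ⊖ A ⊙ B′
  ⊙-distribˡ-⊖ A B B′ zero    = distribˡ-- _ _ _
  ⊙-distribˡ-⊖ A B B′ (suc n) =
    trans (+-cong (distribˡ-- _ _ _) (⊙-distribˡ-⊖ _ B B′ n)) (-‿+-interchange _ _ _ _)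

  ⋆-⊙ : ∀ k A B → (k ⋆ A) ⊙ B ≋ k ⋆ (A ⊙ B)
  ⋆-⊙ k A B zero    = *-assoc _ _ _
  ⋆-⊙ k A B (suc n) = trans (+-cong (*-assoc _ _ _) (⋆-⊙ k _ B n)) (sym (distribˡ _ _ _))

  ⊙-⋆ : ∀ k A B → A ⊙ (k ⋆ B) ≋ k ⋆ (A ⊙ B)
  ⊙-⋆ k A B zero    = x*yz≈y*xz _ _ _
  ⊙-⋆ k A B (suc n) = trans (+-cong (x*yz≈y*xz _ _ _) (⊙-⋆ k _ B n)) (sym (distribˡ _ _ _))

  shift-⊙ : ∀ A B → shift A ⊙ B ≋ shift (A ⊙ B)
  shift-⊙ A B zero    = zeroˡ _
  shift-⊙ A B (suc n) = trans (+-congʳ (zeroˡ _)) (+-identityˡ _)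

  ⊙-shift : ∀ A B → A ⊙ shift B ≋ shift (A ⊙ B)
  ⊙-shift A B zero          = zeroʳ _
  ⊙-shift A B (suc zero)    = trans (+-congˡ (⊙-shift (tail A) B zero)) (+-identityʳ _)
  ⊙-shift A B (suc (suc n)) = +-congˡ (⊙-shift (tail A) B (suc n))

  𝟘-⊙ : ∀ B → 𝟘 ⊙ B ≋ 𝟘
  𝟘-⊙ B zero    = zeroˡ _
  𝟘-⊙ B (suc n) = trans (+-cong (zeroˡ _) (𝟘-⊙ B n)) (+-identityˡ _)

  𝟙-⊙ : ∀ B → 𝟙 ⊙ B ≋ B
  𝟙-⊙ B zero    = *-identityˡ _
  𝟙-⊙ B (suc n) = trans (+-cong (*-identityˡ _) (𝟘-⊙ B n)) (+-identityʳ _)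

  ⊙-suc : ∀ A B n → (A ⊙ B) (suc n) ≈ (A ⊙ tail B) n + A (suc n) * B 0
  ⊙-suc A B zero    = refl
  ⊙-suc A B (suc n) = trans (+-congˡ (⊙-suc (tail A) B n)) (sym (+-assoc _ _ _))

  ⊙-comm : ∀ A B → A ⊙ B ≋ B ⊙ A
  ⊙-comm A B zero    = *-comm _ _
  ⊙-comm A B (suc n) = begin
    A 0 * B (suc n) + (tail A ⊙ B) n  ≈⟨ +-congˡ (⊙-comm _ B n) ⟩
    A 0 * B (suc n) + (B ⊙ tail A) n  ≈⟨ +-comm _ _ ⟩
    (B ⊙ tail A) n + A 0 * B (suc n)  ≈⟨ +-congˡ (*-comm _ _) ⟩
    (B ⊙ tail A) n + B (suc n) * A 0  ≈⟨ sym (⊙-suc B A n) ⟩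
    (B ⊙ A) (suc n)                   ∎

  ⊙-identityʳ : ∀ A → A ⊙ 𝟙 ≋ A
  ⊙-identityʳ A = ≋-trans (⊙-comm A 𝟙) (𝟙-⊙ A)

  ⊙-assoc : ∀ A B C → (A ⊙ B) ⊙ C ≋ A ⊙ (B ⊙ C)
  ⊙-assoc A B C zero    = *-assoc _ _ _
  ⊙-assoc A B C (suc n) = begin
    (A ⊙ B) 0 * C (suc n) + (tail (A ⊙ B) ⊙ C) n
      ≈⟨ +-congˡ (⊙-distribʳ-⊕ (A 0 ⋆ tail B) (tail A ⊙ B) C n) ⟩
    (A ⊙ B) 0 * C (suc n) + (((A 0 ⋆ tail B) ⊙ C) n + ((tail A ⊙ B) ⊙ C) n)
      ≈⟨ +-congˡ (+-cong (⋆-⊙ (A 0) (tail B) C n) (⊙-assoc (tail A) B C n)) ⟩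
    (A 0 * B 0) * C (suc n) + (A 0 * (tail B ⊙ C) n + (tail A ⊙ (B ⊙ C)) n)
      ≈⟨ solve 5 (λ a b c x y → (a :* b) :* c :+ (a :* x :+ y) := a :* (b :* c :+ x) :+ y)
           refl _ _ _ _ _ ⟩
    A 0 * (B ⊙ C) (suc n) + (tail A ⊙ (B ⊙ C)) n ∎

  tail-θ : ∀ A → tail (θ A) ≋ tail A ⊕ θ (tail A)
  tail-θ A n = trans (distribʳ _ _ _) (+-congʳ (*-identityˡ _))

  θ-⊙ : ∀ A B → θ (A ⊙ B) ≋ θ A ⊙ B ⊕ A ⊙ θ B
  θ-⊙ A B zero    = solve 2 (λ a b → :0 :* (a :* b) := (:0 :* a) :* b :+ a :* (:0 :* b)) refl _ _
  θ-⊙ A B (suc n) = begin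
    (1# + k) * (A 0 * B (suc n) + ab)
      ≈⟨ solve 4 (λ k x y ab → (:1 :+ k) :* (x :* y :+ ab) := (ab :+ k :* ab) :+ (:1 :+ k) :* (x :* y))
           refl k (A 0) (B (suc n)) ab ⟩
    (ab + k * ab) + (1# + k) * (A 0 * B (suc n))
      ≈⟨ +-congʳ (+-congˡ (θ-⊙ (tail A) B n)) ⟩
    (ab + (θA′B + A′θB)) + (1# + k) * (A 0 * B (suc n))
      ≈⟨ solve 6 (λ ab p q k x y →
           (ab :+ (p :+ q)) :+ (:1 :+ k) :* (x :* y)
             := ((:0 :* x) :* y :+ (ab :+ p)) :+ (x :* ((:1 :+ k) :* y) :+ q))
           refl ab θA′B A′θB k (A 0) (B (suc n)) ⟩
    ((0# * A 0) * B (suc n) + (ab + θA′B)) + (A 0 * ((1# + k) * B (suc n)) + A′θB)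
      ≈⟨ +-congʳ (+-congˡ (sym (⊙-distribʳ-⊕ (tail A) (θ (tail A)) B n))) ⟩
    ((0# * A 0) * B (suc n) + ((tail A ⊕ θ (tail A)) ⊙ B) n) + (A 0 * ((1# + k) * B (suc n)) + A′θB)
      ≈⟨ +-congʳ (+-congˡ (⊙-cong (≋-sym (tail-θ A)) ≋-refl n)) ⟩
    (θ A ⊙ B) (suc n) + (A ⊙ θ B) (suc n) ∎
    where
    k    = ⟨ n ⟩
    ab   = (tail A ⊙ B) n
    θA′B = (θ (tail A) ⊙ B) n
    A′θB = (tail A ⊙ θ B) n

module NewtonIdentities {c ℓ : Level} (R : CommutativeRing c ℓ) where
  open CommutativeRing R hiding (zero)
  open RingArithmetic R
  open PowerSeries R

  reciprocal : (k : ℕ) → (Fin k → Carrier) → Series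
  reciprocal zero    ξ = 𝟙
  reciprocal (suc k) ξ = Q ⊖ ξ Fin.zero ⋆ shift Q
    where Q = reciprocal k (λ i → ξ (Fin.suc i))

  powerSum : (k : ℕ) → (Fin k → Carrier) → Series
  powerSum k ξ n = sumFin R k (λ i → powR R (ξ i) n)

  geometric : Carrier → Series
  geometric = powR R

  geometric-inverse : ∀ a → geometric a ⊖ a ⋆ shift (geometric a) ≋ 𝟙
  geometric-inverse a zero    = solve 2 (λ o a → o :- a :* :0 := o) refl 1# a
  geometric-inverse a (suc n) = -‿inverseʳ _

  -- P = Σᵢ 1/(1 - ξᵢ t); peel off the factor 1 - ξ₀ t, which inverts the geometric series of ξ₀.
  newton : ∀ k ξ → reciprocal k ξ ⊙ powerSum k ξ ≋ ⟨ k ⟩ ⋆ reciprocal k ξ ⊖ θ (reciprocal k ξ)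
  newton zero    ξ n = trans (𝟙-⊙ (powerSum zero ξ) n) (0≈ n)
    where
    0≈ : ∀ n → 0# ≈ 0# * 𝟙 n - ⟨ n ⟩ * 𝟙 n
    0≈ zero    = solve 1 (λ o → :0 := :0 :* o :- :0 :* o) refl 1#
    0≈ (suc n) = solve 1 (λ x → :0 := :0 :* :0 :- x :* :0) refl ⟨ suc n ⟩
  newton (suc k) ξ = begin
    Q₁ ⊙ (geometric a ⊕ P)                           ≈⟨ ⊙-distribˡ-⊕ Q₁ (geometric a) P ⟩
    Q₁ ⊙ geometric a ⊕ Q₁ ⊙ P                       ≈⟨ (λ n → +-cong (factor-geometric n) (factor-rest n)) ⟩
    Q ⊕ (N ⊖ a ⋆ shift N)                          ≈⟨ collect ⟩
    ⟨ suc k ⟩ ⋆ Q₁ ⊖ θ Q₁                           ∎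
    where
    open ≋-Reasoning
    ξ′ = λ i → ξ (Fin.suc i)
    a  = ξ Fin.zero
    Q  = reciprocal k ξ′
    P  = powerSum k ξ′
    Q₁ = reciprocal (suc k) ξ
    N  = ⟨ k ⟩ ⋆ Q ⊖ θ Q

    Q₁-⊙ : ∀ X → Q₁ ⊙ X ≋ Q ⊙ X ⊖ a ⋆ shift (Q ⊙ X)
    Q₁-⊙ X = begin
      (Q ⊖ a ⋆ shift Q) ⊙ X           ≈⟨ ⊙-distribʳ-⊖ Q _ X ⟩
      Q ⊙ X ⊖ (a ⋆ shift Q) ⊙ X       ≈⟨ (λ n → +-congˡ (-‿cong
                                             (trans (⋆-⊙ a (shift Q) X n) (*-congˡ (shift-⊙ Q X n))))) ⟩
      Q ⊙ X ⊖ a ⋆ shift (Q ⊙ X)       ∎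

    factor-geometric : Q₁ ⊙ geometric a ≋ Q
    factor-geometric = begin
      Q₁ ⊙ geometric a                                  ≈⟨ Q₁-⊙ (geometric a) ⟩
      Q ⊙ geometric a ⊖ a ⋆ shift (Q ⊙ geometric a)     ≈⟨ (λ n → +-congˡ (-‿cong (*-congˡ
                                                             (sym (⊙-shift Q (geometric a) n))))) ⟩
      Q ⊙ geometric a ⊖ a ⋆ (Q ⊙ shift (geometric a))   ≈⟨ (λ n → +-congˡ (-‿cong
                                                             (sym (⊙-⋆ a Q (shift (geometric a)) n)))) ⟩
      Q ⊙ geometric a ⊖ Q ⊙ (a ⋆ shift (geometric a))   ≈⟨ ≋-sym (⊙-distribˡ-⊖ Q _ _) ⟩
      Q ⊙ (geometric a ⊖ a ⋆ shift (geometric a))       ≈⟨ ⊙-cong ≋-refl (geometric-inverse a) ⟩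
      Q ⊙ 𝟙                                            ≈⟨ ⊙-identityʳ Q ⟩
      Q                                                ∎

    factor-rest : Q₁ ⊙ P ≋ N ⊖ a ⋆ shift N
    factor-rest n = trans (Q₁-⊙ P n)
      (+-cong (newton k ξ′ n) (-‿cong (*-congˡ (shift-cong (newton k ξ′) n))))

    collect : Q ⊕ (N ⊖ a ⋆ shift N) ≋ ⟨ suc k ⟩ ⋆ Q₁ ⊖ θ Q₁
    collect zero    = solve 3 (λ q k a →
      q :+ ((k :* q :- :0 :* q) :- a :* :0) := (:1 :+ k) :* (q :- a :* :0) :- :0 :* (q :- a :* :0))
      refl (Q 0) ⟨ k ⟩ a
    collect (suc n) = solve 5 (λ q′ q k n a →
      q′ :+ ((k :* q′ :- (:1 :+ n) :* q′) :- a :* (k :* q :- n :* q))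
        := (:1 :+ k) :* (q′ :- a :* q) :- (:1 :+ n) :* (q′ :- a :* q))
      refl (Q (suc n)) (Q n) ⟨ k ⟩ ⟨ n ⟩ a

module InvertibleConstantTerm {c ℓ : Level} (R : CommutativeRing c ℓ) where
  open CommutativeRing R hiding (zero)
  open PowerSeries R
  open import Relation.Binary.Reasoning.Setoid setoid

  ⊙-vanishingˡ : ∀ X B n → (∀ i → i ≤ n → X i ≈ 0#) → (X ⊙ B) n ≈ 0#
  ⊙-vanishingˡ X B zero    X≈0 = trans (*-congʳ (X≈0 0 z≤n)) (zeroˡ _)
  ⊙-vanishingˡ X B (suc n) X≈0 = trans
    (+-cong (trans (*-congʳ (X≈0 0 z≤n)) (zeroˡ _))
            (⊙-vanishingˡ (tail X) B n (λ i i≤n → X≈0 (suc i) (s≤s i≤n))))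
    (+-identityʳ _)

  -- Since Q 0 = 1, (Q ⊙ E) n is E n plus a combination of lower coefficients of E.
  ⊙-cancelˡ : ∀ Q E → Q 0 ≈ 1# → Q ⊙ E ≋ 𝟘 → E ≋ 𝟘
  ⊙-cancelˡ Q E Q₀≈1 QE≈0 n = upTo n n ℕP.≤-refl
    where
    cancelQ₀ : ∀ x → x * Q 0 ≈ 0# → x ≈ 0#
    cancelQ₀ x p = trans (sym (*-identityʳ x)) (trans (*-congˡ (sym Q₀≈1)) p)
    upTo : ∀ n i → i ≤ n → E i ≈ 0#
    upTo zero zero _ = cancelQ₀ _ (trans (*-comm _ _) (QE≈0 0))
    upTo (suc n) i i≤1+n with ℕP.m≤n⇒m<n∨m≡n i≤1+n
    ... | inj₁ (s≤s i≤n) = upTo n i i≤n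
    ... | inj₂ P.refl    = cancelQ₀ _ (begin
      E (suc n) * Q 0                          ≈⟨ sym (+-identityˡ _) ⟩
      0# + E (suc n) * Q 0                     ≈⟨ +-congʳ (sym (⊙-vanishingˡ E (tail Q) n (upTo n))) ⟩
      (E ⊙ tail Q) n + E (suc n) * Q 0         ≈⟨ sym (⊙-suc E Q n) ⟩
      (E ⊙ Q) (suc n)                          ≈⟨ ⊙-comm E Q (suc n) ⟩
      (Q ⊙ E) (suc n)                          ≈⟨ QE≈0 (suc n) ⟩
      0#                                       ∎)

module Riccati {c ℓ : Level} (R : CommutativeRing c ℓ) where
  open CommutativeRing R hiding (zero)
  open RingArithmetic R
  open PowerSeries R
  open InvertibleConstantTerm R
  open import Relation.Binary.Reasoning.Setoid setoid

  -- P = μ - t Q′/Q satisfies the Riccati equation t P′ = P² + α P + (μ - P)/t;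
  -- riccati-constant and riccati-recurrence are its coefficientwise form.
  module _ (μ α : Carrier) (Q P : Series) (Q₀≈1 : Q 0 ≈ 1#)
           (Q⊙P≈ : Q ⊙ P ≋ μ ⋆ Q ⊖ θ Q)
           (Q-recurrence : ∀ a → ⟨ suc a ⟩ * Q (suc a) ≈ - ((μ - ⟨ a ⟩) * ((μ - ⟨ a ⟩) + α)) * Q a)
           where

    private
      K = Q ⊙ P
      PP = P ⊙ P
      W = θ P ⊖ PP ⊖ α ⋆ P
      E = μ ⋆ 𝟙 ⊖ P ⊖ shift W

      Z : Series
      Z a = - ((μ - ⟨ a ⟩) * ((μ - ⟨ a ⟩) + α)) * Q a

      θQ≈ : θ Q ≋ μ ⋆ Q ⊖ K
      θQ≈ a = trans (solve 2 (λ x y → y := x :- (x :- y)) refl (μ * Q a) (θ Q a))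
                    (+-congˡ (-‿cong (sym (Q⊙P≈ a))))

      θQ≈shiftZ : θ Q ≋ shift Z
      θQ≈shiftZ zero    = zeroˡ _
      θQ≈shiftZ (suc a) = Q-recurrence a

      θQ⊙P≈ : θ Q ⊙ P ≋ μ ⋆ K ⊖ Q ⊙ PP
      θQ⊙P≈ n = begin
        (θ Q ⊙ P) n                   ≈⟨ ⊙-cong θQ≈ ≋-refl n ⟩
        ((μ ⋆ Q ⊖ K) ⊙ P) n           ≈⟨ ⊙-distribʳ-⊖ _ _ P n ⟩
        ((μ ⋆ Q) ⊙ P) n - (K ⊙ P) n   ≈⟨ +-cong (⋆-⊙ μ Q P n) (-‿cong (⊙-assoc Q P P n)) ⟩
        μ * K n - (Q ⊙ PP) n          ∎

      Q⊙W≈ : Q ⊙ W ≋ Q ⊙ θ P ⊖ Q ⊙ PP ⊖ α ⋆ K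
      Q⊙W≈ n = trans (⊙-distribˡ-⊖ Q _ _ n) (+-cong (⊙-distribˡ-⊖ Q _ _ n) (-‿cong (⊙-⋆ α Q P n)))

      Z≈Q⊙W : Z ≋ Q ⊙ W
      Z≈Q⊙W a = begin
        Z a
          ≈⟨ solve 4 (λ m x q al → :- ((m :- x) :* ((m :- x) :+ al)) :* q
                        := x :* (m :* q :- x :* q) :- (m :+ al) :* (m :* q :- x :* q))
               refl μ ⟨ a ⟩ (Q a) α ⟩
        ⟨ a ⟩ * (μ * Q a - ⟨ a ⟩ * Q a) - (μ + α) * (μ * Q a - ⟨ a ⟩ * Q a)
          ≈⟨ +-cong (*-congˡ (sym (Q⊙P≈ a))) (-‿cong (*-congˡ (sym (Q⊙P≈ a)))) ⟩
        θ K a - (μ + α) * K a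
          ≈⟨ +-congʳ (trans (θ-⊙ Q P a) (+-congʳ (θQ⊙P≈ a))) ⟩
        ((μ * K a - (Q ⊙ PP) a) + (Q ⊙ θ P) a) - (μ + α) * K a
          ≈⟨ solve 5 (λ m k x y al → ((m :* k :- x) :+ y) :- (m :+ al) :* k := (y :- x) :- al :* k)
               refl μ (K a) ((Q ⊙ PP) a) ((Q ⊙ θ P) a) α ⟩
        ((Q ⊙ θ P) a - (Q ⊙ PP) a) - α * K a
          ≈⟨ sym (Q⊙W≈ a) ⟩
        (Q ⊙ W) a ∎

      Q⊙E≈0 : Q ⊙ E ≋ 𝟘
      Q⊙E≈0 n = begin
        (Q ⊙ E) n                                          ≈⟨ ⊙-distribˡ-⊖ Q _ _ n ⟩
        (Q ⊙ (μ ⋆ 𝟙 ⊖ P)) n - (Q ⊙ shift W) n              ≈⟨ +-cong (⊙-distribˡ-⊖ Q _ _ n)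
                                                                 (-‿cong (⊙-shift Q W n)) ⟩
        ((Q ⊙ (μ ⋆ 𝟙)) n - K n) - shift (Q ⊙ W) n          ≈⟨ +-congʳ (+-congʳ (trans (⊙-⋆ μ Q 𝟙 n)
                                                                 (*-congˡ (⊙-identityʳ Q n)))) ⟩
        (μ * Q n - K n) - shift (Q ⊙ W) n                  ≈⟨ +-cong (trans (sym (θQ≈ n)) (θQ≈shiftZ n))
                                                                 (-‿cong (shift-cong (≋-sym Z≈Q⊙W) n)) ⟩
        shift Z n - shift Z n                              ≈⟨ -‿inverseʳ _ ⟩
        0#                                                 ∎

      E≈0 : E ≋ 𝟘
      E≈0 = ⊙-cancelˡ Q E Q₀≈1 Q⊙E≈0

    riccati-constant : P 0 ≈ μ
    riccati-constant = begin
      P 0         ≈⟨ solve 2 (λ p m → p := m :- ((m :* :1 :- p) :- :0)) refl (P 0) μ ⟩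
      μ - E 0     ≈⟨ +-congˡ (-‿cong (E≈0 0)) ⟩
      μ - 0#      ≈⟨ solve 1 (λ m → m :- :0 := m) refl μ ⟩
      μ           ∎

    riccati-recurrence : ∀ n → P (suc n) ≈ (α - ⟨ n ⟩) * P n + PP n
    riccati-recurrence n = begin
      P (suc n)
        ≈⟨ solve 6 (λ p′ p x c al m → p′ := ((al :- x) :* p :+ c) :- ((m :* :0 :- p′) :- ((x :* p :- c) :- al :* p)))
             refl (P (suc n)) (P n) ⟨ n ⟩ (PP n) α μ ⟩
      ((α - ⟨ n ⟩) * P n + PP n) - E (suc n)  ≈⟨ +-congˡ (-‿cong (E≈0 (suc n))) ⟩
      ((α - ⟨ n ⟩) * P n + PP n) - 0#         ≈⟨ solve 1 (λ m → m :- :0 := m) refl _ ⟩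
      (α - ⟨ n ⟩) * P n + PP n                ∎

module Conditional where
  open import Relation.Nullary using (Dec; ¬_)
  open import Relation.Nullary.Decidable using (dec-true; dec-false)
  open import Relation.Binary.PropositionalEquality using (_≡_; refl)

  if-yes : ∀ {a b} {A : Set a} {B : Set b} (d : Dec A) {x y : B} → A → (if does d then x else y) ≡ x
  if-yes d a rewrite dec-true d a = refl

  if-no : ∀ {a b} {A : Set a} {B : Set b} (d : Dec A) {x y : B} → ¬ A → (if does d then x else y) ≡ y
  if-no d ¬a rewrite dec-false d ¬a = refl

module LaguerreCoefficients {c ℓ : Level} (R : CommutativeRing c ℓ) where
  open import Data.Nat.Combinatorics using (_C_; nCn≡1)
  open CommutativeRing R hiding (zero)
  open RingArithmetic R
  open Conditional
  open BinomialAbsorption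
  open import Relation.Binary.Reasoning.Setoid setoid

  laguerreCoeff : ℕ → Carrier → ℕ → Carrier
  laguerreCoeff m α j = powR R (- 1#) (m ∸ j) * (⟨ m C j ⟩ * falling R (⟨ m ⟩ + α) (m ∸ j))

  monicLaguerre-low : ∀ m α j → j ≤ m → monicLaguerre R m α j ≈ laguerreCoeff m α j
  monicLaguerre-low m α j j≤m = reflexive (if-yes (j ℕ.≤? m) j≤m)

  monicLaguerre-high : ∀ m α j → m < j → monicLaguerre R m α j ≈ 0#
  monicLaguerre-high m α j m<j = reflexive (if-no (j ℕ.≤? m) (ℕP.<⇒≱ m<j))

  laguerreCoeff-at : ∀ m α j {t} → m ∸ j ≡ t →
    laguerreCoeff m α j ≈ powR R (- 1#) t * (⟨ m C j ⟩ * falling R (⟨ m ⟩ + α) t)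
  laguerreCoeff-at m α j P.refl = refl

  laguerreCoeff-top : ∀ m α → laguerreCoeff m α m ≈ 1#
  laguerreCoeff-top m α = begin
    laguerreCoeff m α m                                        ≈⟨ laguerreCoeff-at m α m (ℕP.n∸n≡0 m) ⟩
    1# * (⟨ m C m ⟩ * 1#)                                      ≈⟨ *-congˡ (*-congʳ (⟨⟩-cong (nCn≡1 m))) ⟩
    1# * ((1# + 0#) * 1#)                                      ≈⟨ solve 0 (:1 :* ((:1 :+ :0) :* :1) := :1) refl ⟩
    1#                                                         ∎

  -- the coefficientwise form of the Laguerre differential equation
  laguerreCoeff-recurrence : ∀ m α i → i < m →
    ⟨ m ∸ i ⟩ * laguerreCoeff m α i ≈ - (⟨ suc i ⟩ * (⟨ suc i ⟩ + α)) * laguerreCoeff m α (suc i)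
  laguerreCoeff-recurrence m α i i<m = begin
    ⟨ m ∸ i ⟩ * laguerreCoeff m α i
      ≈⟨ *-cong (⟨⟩-cong m∸i) (laguerreCoeff-at m α i m∸i) ⟩
    ⟨ suc r ⟩ * ((- 1# * s) * (⟨ m C i ⟩ * (F * (b - ⟨ r ⟩))))
      ≈⟨ solve 5 (λ x s c f d → x :* ((:- :1 :* s) :* (c :* (f :* d))) := :- ((s :* f :* d) :* (x :* c)))
           refl ⟨ suc r ⟩ s ⟨ m C i ⟩ F (b - ⟨ r ⟩) ⟩
    - ((s * F * (b - ⟨ r ⟩)) * (⟨ suc r ⟩ * ⟨ m C i ⟩))
      ≈⟨ -‿cong (*-cong (*-congˡ b-r≈) absorb) ⟩
    - ((s * F * (⟨ suc i ⟩ + α)) * (⟨ suc i ⟩ * ⟨ m C suc i ⟩))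
      ≈⟨ solve 5 (λ s f x a c → :- ((s :* f :* (x :+ a)) :* (x :* c)) := :- (x :* (x :+ a)) :* (s :* (c :* f)))
           refl s F ⟨ suc i ⟩ α ⟨ m C suc i ⟩ ⟩
    - (⟨ suc i ⟩ * (⟨ suc i ⟩ + α)) * laguerreCoeff m α (suc i) ∎
    where
    r = m ∸ suc i
    m∸i : m ∸ i ≡ suc r
    m∸i = ℕP.+-∸-assoc 1 i<m
    b = ⟨ m ⟩ + α
    s = powR R (- 1#) r
    F = falling R b r
    b-r≈ : b - ⟨ r ⟩ ≈ ⟨ suc i ⟩ + α
    b-r≈ = begin
      (⟨ m ⟩ + α) - ⟨ r ⟩                 ≈⟨ +-congʳ (+-congʳ (trans (⟨⟩-cong (P.sym (ℕP.m∸n+n≡m i<m)))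
                                                                     (⟨⟩-+ r (suc i)))) ⟩
      ((⟨ r ⟩ + ⟨ suc i ⟩) + α) - ⟨ r ⟩   ≈⟨ solve 3 (λ x y a → ((x :+ y) :+ a) :- x := y :+ a)
                                                refl ⟨ r ⟩ ⟨ suc i ⟩ α ⟩
      ⟨ suc i ⟩ + α                       ∎
    absorb : ⟨ suc r ⟩ * ⟨ m C i ⟩ ≈ ⟨ suc i ⟩ * ⟨ m C suc i ⟩
    absorb = trans (sym (⟨⟩-* (suc r) (m C i)))
      (trans (⟨⟩-cong (P.trans (P.cong (ℕ._* (m C i)) (P.sym m∸i)) ([n∸k]*nCk≡[1+k]*nC[1+k] m i i<m)))
             (⟨⟩-* (suc i) (m C suc i)))

module ReciprocalPolynomial {c ℓ : Level} (R : CommutativeRing c ℓ) where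
  open CommutativeRing R hiding (zero)
  open RingArithmetic R
  open PowerSeries R
  open NewtonIdentities R
  open import Relation.Binary.Reasoning.Setoid setoid

  private
    0-x*0≈0 : ∀ x → 0# - x * 0# ≈ 0#
    0-x*0≈0 = solve 1 (λ x → :0 :- x :* :0 := :0) refl

  rootPoly-cong : ∀ k ξ {j j′} → j ≡ j′ → rootPoly R k ξ j ≈ rootPoly R k ξ j′
  rootPoly-cong k ξ P.refl = refl

  rootPoly-high : ∀ k ξ j → k < j → rootPoly R k ξ j ≈ 0#
  rootPoly-high zero    ξ (suc j) _         = refl
  rootPoly-high (suc k) ξ (suc j) (s≤s k<j) = trans
    (+-cong (rootPoly-high k _ j k<j) (-‿cong (*-congˡ (rootPoly-high k _ (suc j) (ℕP.m≤n⇒m≤1+n k<j)))))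
    (0-x*0≈0 _)

  rootPoly-top : ∀ k ξ → rootPoly R k ξ k ≈ 1#
  rootPoly-top zero    ξ = refl
  rootPoly-top (suc k) ξ = trans
    (+-cong (rootPoly-top k _) (-‿cong (*-congˡ (rootPoly-high k _ (suc k) ℕP.≤-refl))))
    (solve 1 (λ x → :1 :- x :* :0 := :1) refl _)

  reciprocal-high : ∀ k ξ a → k < a → reciprocal k ξ a ≈ 0#
  reciprocal-high zero    ξ (suc a) _         = refl
  reciprocal-high (suc k) ξ (suc a) (s≤s k<a) = trans
    (+-cong (reciprocal-high k _ (suc a) (ℕP.m≤n⇒m≤1+n k<a)) (-‿cong (*-congˡ (reciprocal-high k _ a k<a))))
    (0-x*0≈0 _)

  reciprocal≈rootPoly : ∀ k ξ a → a ≤ k → reciprocal k ξ a ≈ rootPoly R k ξ (k ∸ a)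
  reciprocal≈rootPoly zero    ξ zero    _ = refl
  reciprocal≈rootPoly (suc k) ξ zero    _ =
    +-cong (reciprocal≈rootPoly k _ 0 z≤n) (-‿cong (*-congˡ (sym (rootPoly-high k _ (suc k) ℕP.≤-refl))))
  reciprocal≈rootPoly (suc k) ξ (suc a) (s≤s a≤k) with ℕP.m≤n⇒m<n∨m≡n a≤k
  ... | inj₁ a<k = begin
    Q (suc a) - ξ Fin.zero * Q a
      ≈⟨ +-cong (reciprocal≈rootPoly k ξ′ (suc a) a<k)
                (-‿cong (*-congˡ (trans (reciprocal≈rootPoly k ξ′ a a≤k) (rootPoly-cong k ξ′ k∸a)))) ⟩
    rootPoly R k ξ′ (k ∸ suc a) - ξ Fin.zero * rootPoly R k ξ′ (suc (k ∸ suc a))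
      ≈⟨ rootPoly-cong (suc k) ξ (P.sym k∸a) ⟩
    rootPoly R (suc k) ξ (k ∸ a) ∎
    where
    ξ′ = λ i → ξ (Fin.suc i)
    Q = reciprocal k ξ′
    k∸a = ℕP.+-∸-assoc 1 a<k
  ... | inj₂ P.refl = begin
    Q (suc a) - ξ Fin.zero * Q a
      ≈⟨ +-cong (reciprocal-high a ξ′ (suc a) ℕP.≤-refl)
                (-‿cong (*-congˡ (trans (reciprocal≈rootPoly a ξ′ a a≤k) (rootPoly-cong a ξ′ (ℕP.n∸n≡0 a))))) ⟩
    0# - ξ Fin.zero * rootPoly R a ξ′ 0   ≈⟨ +-identityˡ _ ⟩
    rootPoly R (suc a) ξ 0                ≈⟨ rootPoly-cong (suc a) ξ (P.sym (ℕP.n∸n≡0 a)) ⟩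
    rootPoly R (suc a) ξ (a ∸ a)          ∎
    where
    ξ′ = λ i → ξ (Fin.suc i)
    Q = reciprocal a ξ′

module ReciprocalLaguerre {c ℓ : Level} (R : CommutativeRing c ℓ)
  (m : ℕ) (α : CommutativeRing.Carrier R) (ξ : Fin m → CommutativeRing.Carrier R)
  (roots : ∀ j → CommutativeRing._≈_ R (rootPoly R m ξ j) (monicLaguerre R m α j)) where
  open CommutativeRing R hiding (zero)
  open RingArithmetic R
  open NewtonIdentities R
  open ReciprocalPolynomial R
  open LaguerreCoefficients R
  open import Relation.Binary.Reasoning.Setoid setoid

  private
    Q = reciprocal m ξ

  reciprocal-laguerre : ∀ a → a ≤ m → Q a ≈ laguerreCoeff m α (m ∸ a)
  reciprocal-laguerre a a≤m =
    trans (reciprocal≈rootPoly m ξ a a≤m) (trans (roots _) (monicLaguerre-low m α (m ∸ a) (ℕP.m∸n≤m m a)))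

  reciprocal-constant : Q 0 ≈ 1#
  reciprocal-constant = trans (reciprocal-laguerre 0 z≤n) (laguerreCoeff-top m α)

  reciprocal-recurrence : ∀ a →
    ⟨ suc a ⟩ * Q (suc a) ≈ - ((⟨ m ⟩ - ⟨ a ⟩) * ((⟨ m ⟩ - ⟨ a ⟩) + α)) * Q a
  reciprocal-recurrence a with a ℕ.<? m
  ... | yes a<m = begin
    ⟨ suc a ⟩ * Q (suc a)
      ≈⟨ *-cong (⟨⟩-cong (P.sym (ℕP.m∸[m∸n]≡n a<m))) (reciprocal-laguerre (suc a) a<m) ⟩
    ⟨ m ∸ i ⟩ * laguerreCoeff m α i
      ≈⟨ laguerreCoeff-recurrence m α i i<m ⟩
    - (⟨ suc i ⟩ * (⟨ suc i ⟩ + α)) * laguerreCoeff m α (suc i)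
      ≈⟨ *-cong (-‿cong (*-cong 1+i≈m-a (+-congʳ 1+i≈m-a)))
                (trans (reflexive (P.cong (laguerreCoeff m α) (P.sym m∸a)))
                       (sym (reciprocal-laguerre a (ℕP.<⇒≤ a<m)))) ⟩
    - ((⟨ m ⟩ - ⟨ a ⟩) * ((⟨ m ⟩ - ⟨ a ⟩) + α)) * Q a ∎
    where
    i = m ∸ suc a
    i<m : i < m
    i<m = ℕP.∸-monoʳ-< {m} {suc a} {0} (s≤s z≤n) a<m
    m∸a : m ∸ a ≡ suc i
    m∸a = ℕP.+-∸-assoc 1 a<m
    1+i≈m-a : ⟨ suc i ⟩ ≈ ⟨ m ⟩ - ⟨ a ⟩
    1+i≈m-a = begin
      ⟨ suc i ⟩                       ≈⟨ solve 2 (λ x y → x := (x :+ y) :- y) refl ⟨ suc i ⟩ ⟨ a ⟩ ⟩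
      (⟨ suc i ⟩ + ⟨ a ⟩) - ⟨ a ⟩     ≈⟨ +-congʳ (trans (sym (⟨⟩-+ (suc i) a))
                                            (⟨⟩-cong (P.trans (P.cong (ℕ._+ a) (P.sym m∸a))
                                                              (ℕP.m∸n+n≡m (ℕP.<⇒≤ a<m))))) ⟩
      ⟨ m ⟩ - ⟨ a ⟩                   ∎
  ... | no a≮m with ℕP.m≤n⇒m<n∨m≡n (ℕP.≮⇒≥ a≮m)
  ...   | inj₁ m<a = trans (*-congˡ (reciprocal-high m ξ (suc a) (ℕP.m≤n⇒m≤1+n m<a)))
            (trans (zeroʳ _) (sym (trans (*-congˡ (reciprocal-high m ξ a m<a)) (zeroʳ _))))
  ...   | inj₂ P.refl = trans (*-congˡ (reciprocal-high a ξ (suc a) ℕP.≤-refl))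
            (trans (zeroʳ _) (sym (trans (*-congʳ (-‿cong (*-congʳ (-‿inverseʳ _))))
              (solve 2 (λ y q → :- (:0 :* y) :* q := :0) refl _ _))))

module FinSums {c ℓ : Level} (R : CommutativeRing c ℓ) where
  open CommutativeRing R hiding (zero)

  sumFin-cong : ∀ n {f g : Fin n → Carrier} → (∀ i → f i ≈ g i) → sumFin R n f ≈ sumFin R n g
  sumFin-cong zero    f≈g = refl
  sumFin-cong (suc n) f≈g = +-cong (f≈g Fin.zero) (sumFin-cong n (λ i → f≈g (Fin.suc i)))

  *-distribˡ-sumFin : ∀ n k (f : Fin n → Carrier) → k * sumFin R n f ≈ sumFin R n (λ i → k * f i)
  *-distribˡ-sumFin zero    k f = zeroʳ k
  *-distribˡ-sumFin (suc n) k f = trans (distribˡ _ _ _) (+-congˡ (*-distribˡ-sumFin n k _))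

module SequenceU {c ℓ : Level} (R : CommutativeRing c ℓ) where
  import Data.Fin.Properties as FinP
  open CommutativeRing R hiding (zero)
  open RingArithmetic R
  open PowerSeries R
  open FinSums R
  open import Relation.Binary.Reasoning.Setoid setoid

  ⊙≈sumFin : ∀ A B n → (A ⊙ B) n ≈ sumFin R (suc n) (λ i → A (toℕ i) * B (n ∸ toℕ i))
  ⊙≈sumFin A B zero    = sym (+-identityʳ _)
  ⊙≈sumFin A B (suc n) = +-congˡ (⊙≈sumFin (tail A) B n)

  uTable≡u : ∀ α m k (i : Fin (suc k)) → uTable R α m k i ≡ u R α m (suc (k ∸ toℕ i))
  uTable≡u α m zero    Fin.zero    = P.refl
  uTable≡u α m (suc k) Fin.zero    = P.refl
  uTable≡u α m (suc k) (Fin.suc i) = uTable≡u α m k i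

  -- Scaling by m turns the recurrence of u into the Riccati recurrence, whose
  -- solution is determined by its constant term.
  m*u≈riccati : ∀ α m (P : Series) → P 0 ≈ ⟨ m ⟩ →
    (∀ n → P (suc n) ≈ (α - ⟨ n ⟩) * P n + (P ⊙ P) n) →
    ∀ n → ⟨ m ⟩ * u R α m (suc n) ≈ P n
  m*u≈riccati α m P P₀ P-recurrence n = upTo n n ℕP.≤-refl
    where
    U = λ j → u R α m (suc j)
    U-cong : ∀ {a b} → a ≡ b → U a ≈ U b
    U-cong P.refl = refl
    upTo : ∀ n j → j ≤ n → ⟨ m ⟩ * U j ≈ P j
    upTo zero zero _ = trans (*-identityʳ _) (sym P₀)
    upTo (suc n) j j≤1+n with ℕP.m≤n⇒m<n∨m≡n j≤1+n
    ... | inj₁ (ℕ.s≤s j≤n) = upTo n j j≤n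
    ... | inj₂ P.refl = begin
      ⟨ m ⟩ * ((α - ⟨ n ⟩) * prev Fin.zero + ⟨ m ⟩ * sumFin R (suc n) (λ i → prev i * prev (opposite i)))
        ≈⟨ *-congˡ (+-congˡ (*-congˡ (sumFin-cong (suc n) (λ i →
             trans (*-cong (prev≈ i) (prev-opposite≈ i)) (*-comm _ _))))) ⟩
      ⟨ m ⟩ * ((α - ⟨ n ⟩) * U n + ⟨ m ⟩ * sumFin R (suc n) F)
        ≈⟨ solve 5 (λ m a x u s → m :* ((a :- x) :* u :+ m :* s) := (a :- x) :* (m :* u) :+ m :* (m :* s))
             refl ⟨ m ⟩ α ⟨ n ⟩ (U n) _ ⟩
      (α - ⟨ n ⟩) * (⟨ m ⟩ * U n) + ⟨ m ⟩ * (⟨ m ⟩ * sumFin R (suc n) F)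
        ≈⟨ +-cong (*-congˡ (upTo n n ℕP.≤-refl))
                  (trans (*-congˡ (*-distribˡ-sumFin (suc n) ⟨ m ⟩ F))
                         (*-distribˡ-sumFin (suc n) ⟨ m ⟩ (λ i → ⟨ m ⟩ * F i))) ⟩
      (α - ⟨ n ⟩) * P n + sumFin R (suc n) (λ i → ⟨ m ⟩ * (⟨ m ⟩ * F i))
        ≈⟨ +-congˡ (sumFin-cong (suc n) (λ i → trans
             (solve 3 (λ m a b → m :* (m :* (a :* b)) := (m :* a) :* (m :* b)) refl ⟨ m ⟩ _ _)
             (*-cong (upTo n (toℕ i) (FinP.toℕ≤pred[n] i)) (upTo n (n ∸ toℕ i) (ℕP.m∸n≤m n (toℕ i)))))) ⟩
      (α - ⟨ n ⟩) * P n + sumFin R (suc n) (λ i → P (toℕ i) * P (n ∸ toℕ i))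
        ≈⟨ +-congˡ (sym (⊙≈sumFin P P n)) ⟩
      (α - ⟨ n ⟩) * P n + (P ⊙ P) n
        ≈⟨ sym (P-recurrence n) ⟩
      P (suc n) ∎
      where
      prev = uTable R α m n
      F : Fin (suc n) → Carrier
      F i = U (toℕ i) * U (n ∸ toℕ i)
      prev≈ : ∀ i → prev i ≈ U (n ∸ toℕ i)
      prev≈ i = reflexive (uTable≡u α m n i)
      prev-opposite≈ : ∀ i → prev (opposite i) ≈ U (toℕ i)
      prev-opposite≈ i = trans (reflexive (uTable≡u α m n (opposite i)))
        (U-cong (P.trans (P.cong (n ∸_) (FinP.opposite-prop i)) (ℕP.m∸[m∸n]≡n (FinP.toℕ≤pred[n] i))))

module IndexedSums {c ℓ : Level} (R : CommutativeRing c ℓ) where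
  open CommutativeRing R hiding (zero)
  open RingArithmetic R
  open import Relation.Binary.Reasoning.Setoid setoid

  ∑ : ℕ → (ℕ → Carrier) → Carrier
  ∑ zero    f = 0#
  ∑ (suc n) f = f 0 + ∑ n (λ l → f (suc l))

  ∑-cong : ∀ n {f g} → (∀ l → l < n → f l ≈ g l) → ∑ n f ≈ ∑ n g
  ∑-cong zero    f≈g = refl
  ∑-cong (suc n) f≈g = +-cong (f≈g 0 (s≤s z≤n)) (∑-cong n (λ l l<n → f≈g (suc l) (s≤s l<n)))

  ∑-+ : ∀ n f g → ∑ n (λ l → f l + g l) ≈ ∑ n f + ∑ n g
  ∑-+ zero    f g = sym (+-identityʳ _)
  ∑-+ (suc n) f g = trans (+-congˡ (∑-+ n _ _)) (+-interchange _ _ _ _)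

  *-distribˡ-∑ : ∀ n k f → k * ∑ n f ≈ ∑ n (λ l → k * f l)
  *-distribˡ-∑ zero    k f = zeroʳ k
  *-distribˡ-∑ (suc n) k f = trans (distribˡ _ _ _) (+-congˡ (*-distribˡ-∑ n k _))

  *-distribʳ-∑ : ∀ n k f → ∑ n f * k ≈ ∑ n (λ l → f l * k)
  *-distribʳ-∑ n k f = trans (*-comm _ _) (trans (*-distribˡ-∑ n k f) (∑-cong n (λ l _ → *-comm _ _)))

  -‿∑ : ∀ n f → - ∑ n f ≈ ∑ n (λ l → - f l)
  -‿∑ zero    f = -0#≈0#
  -‿∑ (suc n) f = trans (sym (-‿+-comm _ _)) (+-congˡ (-‿∑ n _))

  ∑-last : ∀ n f → ∑ (suc n) f ≈ ∑ n f + f n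
  ∑-last zero    f = +-comm _ _
  ∑-last (suc n) f = trans (+-congˡ (∑-last n _)) (sym (+-assoc _ _ _))

  ∑-last-vanishing : ∀ n f → f n ≈ 0# → ∑ (suc n) f ≈ ∑ n f
  ∑-last-vanishing n f fₙ≈0 = trans (∑-last n f) (trans (+-congˡ fₙ≈0) (+-identityʳ _))

  ∑-vanishing : ∀ n f → (∀ l → l < n → f l ≈ 0#) → ∑ n f ≈ 0#
  ∑-vanishing zero    f f≈0 = refl
  ∑-vanishing (suc n) f f≈0 = trans
    (+-cong (f≈0 0 (s≤s z≤n)) (∑-vanishing n _ (λ l l<n → f≈0 (suc l) (s≤s l<n))))
    (+-identityʳ _)

  ∑-single : ∀ n f a → a < n → (∀ l → l < n → l ≢ a → f l ≈ 0#) → ∑ n f ≈ f a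
  ∑-single (suc n) f zero    _         f≈0 =
    trans (+-congˡ (∑-vanishing n _ (λ l l<n → f≈0 (suc l) (s≤s l<n) (λ ())))) (+-identityʳ _)
  ∑-single (suc n) f (suc a) (s≤s a<n) f≈0 = trans
    (+-cong (f≈0 0 (s≤s z≤n) (λ ()))
            (∑-single n _ a a<n (λ l l<n l≢a → f≈0 (suc l) (s≤s l<n) (λ e → l≢a (ℕP.suc-injective e)))))
    (+-identityˡ _)

  ∑-swap : ∀ n k (f : ℕ → ℕ → Carrier) → ∑ n (λ i → ∑ k (f i)) ≈ ∑ k (λ j → ∑ n (λ i → f i j))
  ∑-swap zero    k f = sym (∑-vanishing k _ (λ _ _ → refl))
  ∑-swap (suc n) k f = trans (+-congˡ (∑-swap n k _)) (sym (∑-+ k _ _))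

  sumFin≈∑ : ∀ n (g : ℕ → Carrier) → sumFin R n (λ i → g (toℕ i)) ≈ ∑ n g
  sumFin≈∑ zero    g = refl
  sumFin≈∑ (suc n) g = +-congˡ (sumFin≈∑ n (λ l → g (suc l)))

module IndexedMatrices {c ℓ : Level} (R : CommutativeRing c ℓ) where
  open import Relation.Binary.Definitions using (tri<; tri≈; tri>)
  open CommutativeRing R hiding (zero)
  open IndexedSums R
  open PowerSeries R using (shift)
  open FinSums R
  open Conditional
  open import Relation.Binary.Reasoning.Setoid setoid

  Matrix : Set c
  Matrix = ℕ → ℕ → Carrier

  δ : Matrix
  δ i j = if does (i ℕ.≟ j) then 1# else 0#

  δ-refl : ∀ i → δ i i ≈ 1#
  δ-refl i = reflexive (if-yes (i ℕ.≟ i) P.refl)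

  δ-≢ : ∀ {i j} → i ≢ j → δ i j ≈ 0#
  δ-≢ {i} {j} i≢j = reflexive (if-no (i ℕ.≟ j) i≢j)

  ∑-δˡ : ∀ n a (f : ℕ → Carrier) → a < n → ∑ n (λ l → δ a l * f l) ≈ f a
  ∑-δˡ n a f a<n = trans
    (∑-single n (λ l → δ a l * f l) a a<n (λ l _ l≢a → trans (*-congʳ (δ-≢ (λ a≡l → l≢a (P.sym a≡l)))) (zeroˡ _)))
    (trans (*-congʳ (δ-refl a)) (*-identityˡ _))

  ∑-δʳ : ∀ n a (f : ℕ → Carrier) → a < n → ∑ n (λ l → δ l a * f l) ≈ f a
  ∑-δʳ n a f a<n = trans
    (∑-single n (λ l → δ l a * f l) a a<n (λ l _ l≢a → trans (*-congʳ (δ-≢ l≢a)) (zeroˡ _)))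
    (trans (*-congʳ (δ-refl a)) (*-identityˡ _))

  ∑-δˡ-beyond : ∀ n a (f : ℕ → Carrier) → n ≤ a → ∑ n (λ l → δ a l * f l) ≈ 0#
  ∑-δˡ-beyond n a f n≤a = ∑-vanishing n (λ l → δ a l * f l) (λ l l<n →
    trans (*-congʳ (δ-≢ (λ a≡l → ℕP.<-irrefl (P.sym a≡l) (ℕP.<-≤-trans l<n n≤a)))) (zeroˡ _))

  ∑-δˡ-suc : ∀ n a (f : ℕ → Carrier) → a ≤ n → ∑ n (λ l → δ a (suc l) * f l) ≈ shift f a
  ∑-δˡ-suc n zero    f _       = ∑-vanishing n (λ l → δ 0 (suc l) * f l) (λ l _ → trans (*-congʳ (δ-≢ {0} {suc l} (λ ()))) (zeroˡ _))
  ∑-δˡ-suc n (suc a) f 1+a≤n   = trans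
    (∑-single n (λ l → δ (suc a) (suc l) * f l) a 1+a≤n (λ l _ l≢a → trans (*-congʳ (δ-≢ (λ 1+a≡1+l → l≢a (P.sym (ℕP.suc-injective 1+a≡1+l)))))
                                             (zeroˡ _)))
    (trans (*-congʳ (δ-refl (suc a))) (*-identityˡ _))

  ∑-δʳ-suc : ∀ n a (f : ℕ → Carrier) → a ≤ n → ∑ n (λ l → δ (suc l) a * f l) ≈ shift f a
  ∑-δʳ-suc n zero    f _     = ∑-vanishing n (λ l → δ (suc l) 0 * f l) (λ l _ → trans (*-congʳ (δ-≢ {suc l} {0} (λ ()))) (zeroˡ _))
  ∑-δʳ-suc n (suc a) f 1+a≤n = trans
    (∑-single n (λ l → δ (suc l) (suc a) * f l) a 1+a≤n (λ l _ l≢a → trans (*-congʳ (δ-≢ (λ 1+l≡1+a → l≢a (ℕP.suc-injective 1+l≡1+a))))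
                                             (zeroˡ _)))
    (trans (*-congʳ (δ-refl (suc a))) (*-identityˡ _))

  UpperTriangular : Matrix → Set ℓ
  UpperTriangular A = ∀ i l → l < i → A i l ≈ 0#

  δ-upper : UpperTriangular δ
  δ-upper i l l<i = δ-≢ (λ i≡l → ℕP.<-irrefl (P.sym i≡l) l<i)

  -- Matrices are indexed by ℕ; as n × n matrices only the entries below n count.
  module Square (n : ℕ) where

    infix 4 _≐_
    _≐_ : Matrix → Matrix → Set ℓ
    A ≐ B = ∀ i j → i < n → j < n → A i j ≈ B i j

    ≐-refl : ∀ {A} → A ≐ A
    ≐-refl i j _ _ = refl

    ≐-sym : ∀ {A B} → A ≐ B → B ≐ A
    ≐-sym p i j i<n j<n = sym (p i j i<n j<n)

    ≐-trans : ∀ {A B C} → A ≐ B → B ≐ C → A ≐ C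
    ≐-trans p q i j i<n j<n = trans (p i j i<n j<n) (q i j i<n j<n)

    infixl 7 _·_
    _·_ : Matrix → Matrix → Matrix
    (A · B) i j = ∑ n (λ l → A i l * B l j)

    _^_ : Matrix → ℕ → Matrix
    A ^ zero  = δ
    A ^ suc k = A · A ^ k

    tr : Matrix → Carrier
    tr A = ∑ n (λ i → A i i)

    ·-cong : ∀ {A A′ B B′} → A ≐ A′ → B ≐ B′ → A · B ≐ A′ · B′
    ·-cong p q i j i<n j<n = ∑-cong n (λ l l<n → *-cong (p i l i<n l<n) (q l j l<n j<n))

    ·-assoc : ∀ A B C → (A · B) · C ≐ A · (B · C)
    ·-assoc A B C i j _ _ = begin
      ∑ n (λ l → ∑ n (λ p → A i p * B p l) * C l j)   ≈⟨ ∑-cong n (λ l _ → trans (*-distribʳ-∑ n _ _)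
                                                             (∑-cong n (λ p _ → *-assoc _ _ _))) ⟩
      ∑ n (λ l → ∑ n (λ p → A i p * (B p l * C l j))) ≈⟨ ∑-swap n n _ ⟩
      ∑ n (λ p → ∑ n (λ l → A i p * (B p l * C l j))) ≈⟨ ∑-cong n (λ p _ → sym (*-distribˡ-∑ n _ _)) ⟩
      ∑ n (λ p → A i p * ∑ n (λ l → B p l * C l j))   ∎

    ·-identityʳ : ∀ A → A · δ ≐ A
    ·-identityʳ A i j _ j<n = trans
      (∑-single n _ j j<n (λ l _ l≢j → trans (*-congˡ (δ-≢ l≢j)) (zeroʳ _)))
      (trans (*-congˡ (δ-refl j)) (*-identityʳ _))

    ·-identityˡ : ∀ A → δ · A ≐ A
    ·-identityˡ A i j i<n _ = trans
      (∑-single n _ i i<n (λ l _ l≢i → trans (*-congʳ (δ-≢ (λ i≡l → l≢i (P.sym i≡l)))) (zeroˡ _)))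
      (trans (*-congʳ (δ-refl i)) (*-identityˡ _))

    tr-cong : ∀ {A B} → A ≐ B → tr A ≈ tr B
    tr-cong p = ∑-cong n (λ i i<n → p i i i<n i<n)

    tr-·-comm : ∀ A B → tr (A · B) ≈ tr (B · A)
    tr-·-comm A B = trans (∑-swap n n _) (∑-cong n (λ l _ → ∑-cong n (λ i _ → *-comm _ _)))

    ^-intertwine : ∀ T K C → T · K ≐ K · C → ∀ k → T ^ k · K ≐ K · C ^ k
    ^-intertwine T K C TK≐KC zero    = ≐-trans (·-identityˡ K) (≐-sym (·-identityʳ K))
    ^-intertwine T K C TK≐KC (suc k) =
      ≐-trans (·-assoc T (T ^ k) K)
      (≐-trans (·-cong {T} ≐-refl (^-intertwine T K C TK≐KC k))
      (≐-trans (≐-sym (·-assoc T K (C ^ k)))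
      (≐-trans (·-cong TK≐KC ≐-refl)
               (·-assoc K C (C ^ k)))))

    tr-^-similar : ∀ T C K L → K · L ≐ δ → L · K ≐ δ → T · K ≐ K · C → ∀ k → tr (T ^ k) ≈ tr (C ^ k)
    tr-^-similar T C K L KL≐δ LK≐δ TK≐KC k = begin
      tr A                  ≈⟨ tr-cong (≐-sym (≐-trans (·-cong {A} ≐-refl KL≐δ) (·-identityʳ A))) ⟩
      tr (A · (K · L))      ≈⟨ tr-cong (≐-sym (·-assoc A K L)) ⟩
      tr ((A · K) · L)      ≈⟨ tr-cong (·-cong (^-intertwine T K C TK≐KC k) (≐-refl {L})) ⟩
      tr ((K · B) · L)      ≈⟨ tr-cong (·-assoc K B L) ⟩
      tr (K · (B · L))      ≈⟨ tr-·-comm K (B · L) ⟩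
      tr ((B · L) · K)      ≈⟨ tr-cong (·-assoc B L K) ⟩
      tr (B · (L · K))      ≈⟨ tr-cong (≐-trans (·-cong {B} ≐-refl LK≐δ) (·-identityʳ B)) ⟩
      tr B                  ∎
      where
      A = T ^ k
      B = C ^ k

    ·-upper : ∀ A B → UpperTriangular A → UpperTriangular B → UpperTriangular (A · B)
    ·-upper A B A↑ B↑ i j j<i = ∑-vanishing n _ (λ l _ → vanish l)
      where
      vanish : ∀ l → A i l * B l j ≈ 0#
      vanish l with ℕP.<-cmp l i
      ... | tri< l<i _ _     = trans (*-congʳ (A↑ i l l<i)) (zeroˡ _)
      ... | tri≈ _ P.refl _  = trans (*-congˡ (B↑ l j j<i)) (zeroʳ _)
      ... | tri> _ _ i<l     = trans (*-congˡ (B↑ l j (ℕP.<-trans j<i i<l))) (zeroʳ _)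

    ·-upper-diagonal : ∀ A B → UpperTriangular A → UpperTriangular B → ∀ i → i < n →
      (A · B) i i ≈ A i i * B i i
    ·-upper-diagonal A B A↑ B↑ i i<n = ∑-single n _ i i<n (λ l _ l≢i → vanish l l≢i)
      where
      vanish : ∀ l → l ≢ i → A i l * B l i ≈ 0#
      vanish l l≢i with ℕP.<-cmp l i
      ... | tri< l<i _ _ = trans (*-congʳ (A↑ i l l<i)) (zeroˡ _)
      ... | tri≈ _ l≡i _ = ⊥-elim (l≢i l≡i)
      ... | tri> _ _ i<l = trans (*-congˡ (B↑ l i i<l)) (zeroʳ _)

    ^-upper : ∀ C → UpperTriangular C → ∀ k → UpperTriangular (C ^ k)
    ^-upper C C↑ zero    = δ-upper
    ^-upper C C↑ (suc k) = ·-upper C _ C↑ (^-upper C C↑ k)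

    ^-upper-diagonal : ∀ C → UpperTriangular C → ∀ k i → i < n → (C ^ k) i i ≈ powR R (C i i) k
    ^-upper-diagonal C C↑ zero    i _   = δ-refl i
    ^-upper-diagonal C C↑ (suc k) i i<n =
      trans (·-upper-diagonal C _ C↑ (^-upper C C↑ k) i i<n) (*-congˡ (^-upper-diagonal C C↑ k i i<n))

    powMat≈^ : ∀ (A : Mat R n) (A′ : Matrix) → (∀ i j → A i j ≈ A′ (toℕ i) (toℕ j)) →
      ∀ k i j → powMat R n A k i j ≈ (A′ ^ k) (toℕ i) (toℕ j)
    powMat≈^ A A′ A≈ zero    i j = refl
    powMat≈^ A A′ A≈ (suc k) i j = trans
      (sumFin-cong n (λ l → *-cong (A≈ i l) (powMat≈^ A A′ A≈ k l j)))
      (sumFin≈∑ n (λ l → A′ (toℕ i) l * (A′ ^ k) l (toℕ j)))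

    trace-powMat≈tr : ∀ (A : Mat R n) (A′ : Matrix) → (∀ i j → A i j ≈ A′ (toℕ i) (toℕ j)) →
      ∀ k → trace R n (powMat R n A k) ≈ tr (A′ ^ k)
    trace-powMat≈tr A A′ A≈ k =
      trans (sumFin-cong n (λ i → powMat≈^ A A′ A≈ k i i)) (sumFin≈∑ n (λ i → (A′ ^ k) i i))

module PolynomialFamilies {c ℓ : Level} (R : CommutativeRing c ℓ) where
  open CommutativeRing R hiding (zero)
  open RingArithmetic R
  open PowerSeries R
  open IndexedSums R
  open IndexedMatrices R using (δ; ∑-δˡ)
  open import Relation.Binary.Reasoning.Setoid setoid

  infixl 7 _⊛_
  _⊛_ : Series → Series → Series
  (x ⊛ y) l = x l * y l

  lincomb : ℕ → Series → (ℕ → Series) → Series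
  lincomb n cf F a = ∑ n (λ l → cf l * F l a)

  previous : (ℕ → Series) → ℕ → Series
  previous F zero    = 𝟘
  previous F (suc i) = F i

  MonicFamily : (ℕ → Series) → Set ℓ
  MonicFamily F = (∀ l → F l l ≈ 1#) × (∀ l a → l < a → F l a ≈ 0#)

  lincomb-cong : ∀ n {x y} F → (∀ l → l < n → x l ≈ y l) → lincomb n x F ≋ lincomb n y F
  lincomb-cong n F x≈y a = ∑-cong n (λ l l<n → *-congʳ (x≈y l l<n))

  lincomb-⊕ : ∀ n x y F → lincomb n (x ⊕ y) F ≋ lincomb n x F ⊕ lincomb n y F
  lincomb-⊕ n x y F a = trans (∑-cong n (λ l _ → distribʳ _ _ _)) (∑-+ n _ _)

  lincomb-⋆ : ∀ n k x F → lincomb n (k ⋆ x) F ≋ k ⋆ lincomb n x F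
  lincomb-⋆ n k x F a = trans (∑-cong n (λ l _ → *-assoc _ _ _)) (sym (*-distribˡ-∑ n k _))

  lincomb-⊖ : ∀ n x y F → lincomb n (x ⊖ y) F ≋ lincomb n x F ⊖ lincomb n y F
  lincomb-⊖ n x y F a = begin
    ∑ n (λ l → (x l - y l) * F l a)           ≈⟨ ∑-cong n (λ l _ → trans (distribʳ _ _ _)
                                                    (+-congˡ (sym (-‿distribˡ-* _ _)))) ⟩
    ∑ n (λ l → x l * F l a + - (y l * F l a)) ≈⟨ ∑-+ n _ _ ⟩
    lincomb n x F a + ∑ n (λ l → - (y l * F l a)) ≈⟨ +-congˡ (sym (-‿∑ n _)) ⟩
    lincomb n x F a - lincomb n y F a          ∎

  lincomb-congᶠ : ∀ n x {F H} → (∀ l → l < n → F l ≋ H l) → lincomb n x F ≋ lincomb n x H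
  lincomb-congᶠ n x F≋H a = ∑-cong n (λ l l<n → *-congˡ (F≋H l l<n a))

  lincomb-𝟘 : ∀ n F → lincomb n 𝟘 F ≋ 𝟘
  lincomb-𝟘 n F a = ∑-vanishing n _ (λ _ _ → zeroˡ _)

  monic-zero : ∀ F → MonicFamily F → F 0 ≋ 𝟙
  monic-zero F (F-top , F-high) zero    = F-top 0
  monic-zero F (F-top , F-high) (suc a) = F-high 0 (suc a) (s≤s ℕ.z≤n)

  lincomb-⊕ᶠ : ∀ n x F H → lincomb n x (λ l → F l ⊕ H l) ≋ lincomb n x F ⊕ lincomb n x H
  lincomb-⊕ᶠ n x F H a = trans (∑-cong n (λ l _ → distribˡ _ _ _)) (∑-+ n _ _)

  lincomb-⋆ᶠ : ∀ n x y F → lincomb n x (λ l → y l ⋆ F l) ≋ lincomb n (y ⊛ x) F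
  lincomb-⋆ᶠ n x y F a = ∑-cong n (λ l _ → x*yz≈yx*z _ _ _)

  lincomb-δ : ∀ n F i → i < n → lincomb n (δ i) F ≋ F i
  lincomb-δ n F i i<n a = ∑-δˡ n i (λ l → F l a) i<n

  lincomb-last : ∀ n x F → x n ≈ 0# → lincomb (suc n) x F ≋ lincomb n x F
  lincomb-last n x F xₙ≈0 a = ∑-last-vanishing n _ (trans (*-congʳ xₙ≈0) (zeroˡ _))

  shift-lincomb : ∀ n x F → shift (lincomb n x F) ≋ lincomb n x (λ l → shift (F l))
  shift-lincomb n x F zero    = sym (∑-vanishing n _ (λ _ _ → zeroʳ _))
  shift-lincomb n x F (suc a) = refl

  lincomb-suc : ∀ n x F → x n ≈ 0# → lincomb (suc n) x (λ l → F (suc l)) ≋ lincomb (suc n) (shift x) F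
  lincomb-suc n x F xₙ≈0 a = begin
    ∑ (suc n) (λ l → x l * F (suc l) a)            ≈⟨ lincomb-last n x (λ l → F (suc l)) xₙ≈0 a ⟩
    ∑ n (λ l → x l * F (suc l) a)                  ≈⟨ solve 2 (λ s f → s := :0 :* f :+ s) refl _ (F 0 a) ⟩
    0# * F 0 a + ∑ n (λ l → x l * F (suc l) a)     ∎

  lincomb-previous : ∀ n x F → x (suc n) ≈ 0# → lincomb (suc n) x (previous F) ≋ lincomb (suc n) (tail x) F
  lincomb-previous n x F x₁₊ₙ≈0 a = begin
    x 0 * 0# + lincomb n (tail x) F a                 ≈⟨ trans (+-congʳ (zeroʳ _)) (+-identityˡ _) ⟩
    lincomb n (tail x) F a                            ≈⟨ sym (lincomb-last n (tail x) F x₁₊ₙ≈0 a) ⟩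
    lincomb (suc n) (tail x) F a                      ∎

  lincomb-compose : ∀ n (x : Series) (Y : ℕ → Series) (F G : ℕ → Series) →
    (∀ j → j < n → F j ≋ lincomb n (Y j) G) →
    lincomb n x F ≋ lincomb n (λ l → ∑ n (λ j → x j * Y j l)) G
  lincomb-compose n x Y F G F≋ a = begin
    ∑ n (λ j → x j * F j a)                         ≈⟨ ∑-cong n (λ j j<n → trans (*-congˡ (F≋ j j<n a))
                                                          (*-distribˡ-∑ n (x j) _)) ⟩
    ∑ n (λ j → ∑ n (λ l → x j * (Y j l * G l a)))   ≈⟨ ∑-swap n n _ ⟩
    ∑ n (λ l → ∑ n (λ j → x j * (Y j l * G l a)))   ≈⟨ ∑-cong n (λ l _ → trans
                                                          (∑-cong n (λ j _ → sym (*-assoc _ _ _)))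
                                                          (sym (*-distribʳ-∑ n _ _))) ⟩
    ∑ n (λ l → ∑ n (λ j → x j * Y j l) * G l a)     ∎

  lincomb-vanishing : ∀ F → MonicFamily F → ∀ n x → lincomb n x F ≋ 𝟘 → ∀ l → l < n → x l ≈ 0#
  lincomb-vanishing F (F-top , F-high) (suc n) x comb≈0 l l<1+n = go l l<1+n
    where
    xₙ≈0 : x n ≈ 0#
    xₙ≈0 = begin
      x n                                ≈⟨ sym (*-identityʳ _) ⟩
      x n * 1#                           ≈⟨ *-congˡ (sym (F-top n)) ⟩
      x n * F n n                        ≈⟨ sym (+-identityˡ _) ⟩
      0# + x n * F n n                   ≈⟨ +-congʳ (sym (∑-vanishing n _ (λ j j<n →
                                              trans (*-congˡ (F-high j n j<n)) (zeroʳ _)))) ⟩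
      lincomb n x F n + x n * F n n      ≈⟨ sym (∑-last n _) ⟩
      lincomb (suc n) x F n              ≈⟨ comb≈0 n ⟩
      0#                                 ∎
    go : ∀ l → l < suc n → x l ≈ 0#
    go l (s≤s l≤n) with ℕP.m≤n⇒m<n∨m≡n l≤n
    ... | inj₁ l<n    = lincomb-vanishing F (F-top , F-high) n x
                          (≋-trans (≋-sym (lincomb-last n x F xₙ≈0)) comb≈0) l l<n
    ... | inj₂ P.refl = xₙ≈0

  lincomb-injective : ∀ F → MonicFamily F → ∀ n x y → lincomb n x F ≋ lincomb n y F →
    ∀ l → l < n → x l ≈ y l
  lincomb-injective F monic n x y x≋y l l<n = begin
    x l                   ≈⟨ solve 2 (λ x y → x := (x :- y) :+ y) refl (x l) (y l) ⟩
    (x l - y l) + y l     ≈⟨ +-congʳ (lincomb-vanishing F monic n (x ⊖ y) difference l l<n) ⟩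
    0# + y l              ≈⟨ +-identityˡ _ ⟩
    y l                   ∎
    where
    difference : lincomb n (x ⊖ y) F ≋ 𝟘
    difference a = trans (lincomb-⊖ n x y F a) (trans (+-congʳ (x≋y a)) (-‿inverseʳ _))

module PartialRootProducts {c ℓ : Level} (R : CommutativeRing c ℓ) where
  open CommutativeRing R hiding (zero)
  open RingArithmetic R
  open PowerSeries R
  open PolynomialFamilies R
  open ReciprocalPolynomial R using (rootPoly-high; rootPoly-top)

  linearFactor : Carrier → Series → Series
  linearFactor a A = shift A ⊖ a ⋆ A

  rootPoly-suc : ∀ k (η : Fin (suc k) → Carrier) →
    rootPoly R (suc k) η ≋ linearFactor (η Fin.zero) (rootPoly R k (λ i → η (Fin.suc i)))
  rootPoly-suc k η zero    = sym (+-identityˡ _)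
  rootPoly-suc k η (suc j) = refl

  linearFactor-cong : ∀ {a b A B} → a ≈ b → A ≋ B → linearFactor a A ≋ linearFactor b B
  linearFactor-cong a≈b A≋B = λ n → +-cong (shift-cong A≋B n) (-‿cong (*-cong a≈b (A≋B n)))

  linearFactor-comm : ∀ a b A → linearFactor a (linearFactor b A) ≋ linearFactor b (linearFactor a A)
  linearFactor-comm a b A zero = solve 3 (λ a b x →
    :0 :- a :* (:0 :- b :* x) := :0 :- b :* (:0 :- a :* x)) refl a b (A 0)
  linearFactor-comm a b A (suc zero) = solve 4 (λ a b x y →
    (:0 :- b :* x) :- a :* (x :- b :* y) := (:0 :- a :* x) :- b :* (x :- a :* y)) refl a b (A 0) (A 1)
  linearFactor-comm a b A (suc (suc n)) = solve 5 (λ a b x y z →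
    (x :- b :* y) :- a :* (y :- b :* z) := (x :- a :* y) :- b :* (y :- a :* z))
    refl a b (A n) (A (suc n)) (A (suc (suc n)))

  rootPoly-cong : ∀ k {η η′ : Fin k → Carrier} → (∀ i → η i ≈ η′ i) → rootPoly R k η ≋ rootPoly R k η′
  rootPoly-cong zero    η≈ zero    = refl
  rootPoly-cong zero    η≈ (suc n) = refl
  rootPoly-cong (suc k) {η} {η′} η≈ = ≋-trans (rootPoly-suc k η)
    (≋-trans (linearFactor-cong (η≈ Fin.zero) (rootPoly-cong k (λ i → η≈ (Fin.suc i))))
             (≋-sym (rootPoly-suc k η′)))

  partialProduct : (ℕ → Carrier) → ℕ → Series
  partialProduct ξ j = rootPoly R j (λ l → ξ (toℕ l))

  partialProduct-zero : ∀ ξ → partialProduct ξ 0 ≋ 𝟙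
  partialProduct-zero ξ zero    = refl
  partialProduct-zero ξ (suc n) = refl

  partialProduct-suc : ∀ ξ j → partialProduct ξ (suc j) ≋ linearFactor (ξ j) (partialProduct ξ j)
  partialProduct-suc ξ zero    = ≋-trans (rootPoly-suc 0 _)
    (linearFactor-cong refl (≋-trans (partialProduct-zero (λ l → ξ (suc l))) (≋-sym (partialProduct-zero ξ))))
  partialProduct-suc ξ (suc j) = begin
    partialProduct ξ (suc (suc j))                                         ≈⟨ rootPoly-suc (suc j) _ ⟩
    linearFactor (ξ 0) (partialProduct ξ′ (suc j))                          ≈⟨ linearFactor-cong refl
                                                                               (partialProduct-suc ξ′ j) ⟩
    linearFactor (ξ 0) (linearFactor (ξ (suc j)) (partialProduct ξ′ j))     ≈⟨ linearFactor-comm _ _ _ ⟩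
    linearFactor (ξ (suc j)) (linearFactor (ξ 0) (partialProduct ξ′ j))     ≈⟨ linearFactor-cong refl
                                                                               (≋-sym (rootPoly-suc j _)) ⟩
    linearFactor (ξ (suc j)) (partialProduct ξ (suc j))                     ∎
    where
    open ≋-Reasoning
    ξ′ = λ l → ξ (suc l)

  partialProduct-monic : ∀ ξ → MonicFamily (partialProduct ξ)
  partialProduct-monic ξ = (λ l → rootPoly-top l _) , (λ l a l<a → rootPoly-high l _ a l<a)

module LaguerreThreeTerm {c ℓ : Level} (R : CommutativeRing c ℓ) (α : CommutativeRing.Carrier R) where
  open import Data.Nat.Combinatorics using (_C_; nCk+nC[k+1]≡[n+1]C[k+1])
  open CommutativeRing R hiding (zero)
  open RingArithmetic R
  open PowerSeries R
  open PolynomialFamilies R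
  open LaguerreCoefficients R
  open BinomialAbsorption
  open import Relation.Binary.Reasoning.Setoid setoid

  laguerre : ℕ → Series
  laguerre i = monicLaguerre R i α

  d e : ℕ → Carrier
  d i = ⟨ 2 ℕ.* i ℕ.+ 1 ⟩ + α
  e i = ⟨ i ⟩ * (⟨ i ⟩ + α)

  laguerre-monic : MonicFamily laguerre
  laguerre-monic = (λ j → trans (monicLaguerre-low j α j ℕP.≤-refl) (laguerreCoeff-top j α))
                 , (λ j a j<a → monicLaguerre-high j α a j<a)

  laguerre-at : ∀ j a {t} → a ≤ j → j ∸ a ≡ t →
    laguerre j a ≈ powR R (- 1#) t * (⟨ j C a ⟩ * falling R (⟨ j ⟩ + α) t)
  laguerre-at j a a≤j j∸a = trans (monicLaguerre-low j α a a≤j) (laguerreCoeff-at j α a j∸a)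

  falling-cong : ∀ {b b′} r → b ≈ b′ → falling R b r ≈ falling R b′ r
  falling-cong zero    b≈b′ = refl
  falling-cong (suc r) b≈b′ = *-cong (falling-cong r b≈b′) (+-congʳ b≈b′)

  falling-suc : ∀ b r → falling R (1# + b) (suc r) ≈ (1# + b) * falling R b r
  falling-suc b zero    = solve 1 (λ b → :1 :* ((:1 :+ b) :- :0) := (:1 :+ b) :* :1) refl b
  falling-suc b (suc r) = begin
    falling R (1# + b) (suc r) * ((1# + b) - (1# + ⟨ r ⟩))   ≈⟨ *-congʳ (falling-suc b r) ⟩
    ((1# + b) * falling R b r) * ((1# + b) - (1# + ⟨ r ⟩))   ≈⟨ solve 4 (λ o b f x →
        ((o :+ b) :* f) :* ((o :+ b) :- (o :+ x)) := (o :+ b) :* (f :* (b :- x))) refl 1# b (falling R b r) ⟨ r ⟩ ⟩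
    (1# + b) * (falling R b r * (b - ⟨ r ⟩))                 ∎

  falling-step : ∀ i r → falling R (⟨ suc i ⟩ + α) (suc r) ≈ (⟨ suc i ⟩ + α) * falling R (⟨ i ⟩ + α) r
  falling-step i r = begin
    falling R (⟨ suc i ⟩ + α) (suc r)            ≈⟨ falling-cong (suc r) (+-assoc _ _ _) ⟩
    falling R (1# + (⟨ i ⟩ + α)) (suc r)         ≈⟨ falling-suc _ r ⟩
    (1# + (⟨ i ⟩ + α)) * falling R (⟨ i ⟩ + α) r ≈⟨ *-congʳ (sym (+-assoc _ _ _)) ⟩
    (⟨ suc i ⟩ + α) * falling R (⟨ i ⟩ + α) r    ∎

  d≈ : ∀ i → d i ≈ ((⟨ i ⟩ + ⟨ i ⟩) + 1#) + α
  d≈ i = +-congʳ (begin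
    ⟨ 2 ℕ.* i ℕ.+ 1 ⟩        ≈⟨ ⟨⟩-+ (2 ℕ.* i) 1 ⟩
    ⟨ i ℕ.+ (i ℕ.+ 0) ⟩ + ⟨ 1 ⟩ ≈⟨ +-cong (trans (⟨⟩-+ i (i ℕ.+ 0)) (+-congˡ (⟨⟩-cong (ℕP.+-identityʳ i))))
                                         (+-identityʳ _) ⟩
    (⟨ i ⟩ + ⟨ i ⟩) + 1#      ∎)

  -- The three-term recurrence at a coefficient a ≤ i, after the binomial
  -- coefficients have been related by Pascal's rule (C = x + y) and by
  -- absorption (a y = (1 + r) x), is a polynomial identity.
  three-term-identity : ∀ (σ G C x y a r i : Carrier) → i ≈ a + r → C ≈ x + y → a * y ≈ (1# + r) * x →
    σ * (C * ((1# + i + α) * G))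
      ≈ (σ * (x * (G * (a + α))) - (((i + i) + 1#) + α) * (- σ * (y * G))) - σ * ((r * y) * G)
  three-term-identity σ G C x y a r i i≈a+r C≈x+y ay≈[1+r]x = begin
    σ * (C * ((1# + i + α) * G))
      ≈⟨ *-congˡ (*-cong C≈x+y (*-congʳ (+-congʳ (+-congˡ i≈a+r)))) ⟩
    σ * ((x + y) * ((1# + (a + r) + α) * G))
      ≈⟨ solve 7 (λ σ g x y a r al →
           σ :* ((x :+ y) :* ((:1 :+ (a :+ r) :+ al) :* g))
             := σ :* g :* (x :* a :+ x :* al :+ a :* y :+ y :+ y :* r :+ y :* al) :+ σ :* g :* ((:1 :+ r) :* x))
           refl σ G x y a r α ⟩
    S + σ * G * ((1# + r) * x)
      ≈⟨ +-congˡ (*-congˡ (sym ay≈[1+r]x)) ⟩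
    S + σ * G * (a * y)
      ≈⟨ solve 7 (λ σ g x y a r al →
           σ :* g :* (x :* a :+ x :* al :+ a :* y :+ y :+ y :* r :+ y :* al) :+ σ :* g :* (a :* y)
             := (σ :* (x :* (g :* (a :+ al))) :- ((((a :+ r) :+ (a :+ r)) :+ :1) :+ al) :* (:- σ :* (y :* g)))
                :- σ :* ((r :* y) :* g))
           refl σ G x y a r α ⟩
    (σ * (x * (G * (a + α))) - ((((a + r) + (a + r)) + 1#) + α) * (- σ * (y * G))) - σ * ((r * y) * G)
      ≈⟨ +-congʳ (+-congˡ (-‿cong (*-congʳ (+-congʳ (+-congʳ (sym (+-cong i≈a+r i≈a+r))))))) ⟩
    (σ * (x * (G * (a + α))) - (((i + i) + 1#) + α) * (- σ * (y * G))) - σ * ((r * y) * G) ∎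
    where
    S = σ * G * (x * a + x * α + a * y + y + y * r + y * α)

  sgn : ℕ → Carrier
  sgn = powR R (- 1#)

  sgn-suc-suc : ∀ t → sgn t ≈ sgn (suc (suc t))
  sgn-suc-suc t = solve 1 (λ s → s := :- :1 :* (:- :1 :* s)) refl (sgn t)

  φ : ℕ → ℕ → Carrier
  φ i r = falling R (⟨ i ⟩ + α) r

  e*previous-laguerre-low : ∀ i a → a ≤ i →
    e i * previous laguerre i a ≈ sgn (suc (i ∸ a)) * ((⟨ i ∸ a ⟩ * ⟨ i C a ⟩) * φ i (i ∸ a))
  e*previous-laguerre-low zero    a _ =
    trans (solve 4 (λ e s y g → e :* :0 := s :* ((:0 :* y) :* g)) refl (e 0) _ _ _)
          (*-congˡ (*-congʳ (*-congʳ (⟨⟩-cong (P.sym (ℕP.0∸n≡0 a))))))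
  e*previous-laguerre-low (suc j) a a≤1+j with ℕP.m≤n⇒m<n∨m≡n a≤1+j
  ... | inj₂ P.refl = trans (*-congˡ (monicLaguerre-high j α (suc j) ℕP.≤-refl))
      (trans (zeroʳ _) (trans (solve 3 (λ s y g → :0 := s :* ((:0 :* y) :* g)) refl _ _ _)
                              (*-congˡ (*-congʳ (*-congʳ (⟨⟩-cong (P.sym (ℕP.n∸n≡0 (suc j)))))))))
  ... | inj₁ (s≤s a≤j) = begin
    e (suc j) * laguerre j a
      ≈⟨ *-congˡ (trans (laguerre-at j a a≤j P.refl) (*-congʳ (sgn-suc-suc r))) ⟩
    (I * (I + α)) * (sgn (suc (suc r)) * (⟨ j C a ⟩ * φ j r))
      ≈⟨ solve 5 (λ I al s z f → (I :* (I :+ al)) :* (s :* (z :* f)) := s :* ((I :* z) :* ((I :+ al) :* f)))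
           refl I α _ ⟨ j C a ⟩ (φ j r) ⟩
    sgn (suc (suc r)) * ((I * ⟨ j C a ⟩) * ((I + α) * φ j r))
      ≈⟨ *-congˡ (*-cong absorb (sym (falling-step j r))) ⟩
    sgn (suc (suc r)) * ((⟨ suc r ⟩ * ⟨ suc j C a ⟩) * φ (suc j) (suc r))
      ≈⟨ reflexive (P.cong (λ t → sgn (suc t) * ((⟨ t ⟩ * ⟨ suc j C a ⟩) * φ (suc j) t)) (P.sym 1+j∸a)) ⟩
    sgn (suc (suc j ∸ a)) * ((⟨ suc j ∸ a ⟩ * ⟨ suc j C a ⟩) * φ (suc j) (suc j ∸ a)) ∎
    where
    r = j ∸ a
    I = ⟨ suc j ⟩
    1+j∸a : suc j ∸ a ≡ suc r
    1+j∸a = ℕP.+-∸-assoc 1 a≤j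
    absorb : I * ⟨ j C a ⟩ ≈ ⟨ suc r ⟩ * ⟨ suc j C a ⟩
    absorb = trans (sym (⟨⟩-* (suc j) (j C a)))
      (trans (⟨⟩-cong (P.sym (P.trans (P.cong (ℕ._* (suc j C a)) (P.sym 1+j∸a))
                                      ([1+n∸k]*[1+n]Ck≡[1+n]*nCk j a a≤j))))
             (⟨⟩-* (suc r) (suc j C a)))

  module _ (i a : ℕ) (a≤i : a ≤ i) where
    private
      r = i ∸ a
      i≈a+r : ⟨ i ⟩ ≈ ⟨ a ⟩ + ⟨ r ⟩
      i≈a+r = trans (⟨⟩-cong (P.sym (ℕP.m+[n∸m]≡n a≤i))) (⟨⟩-+ a r)

    laguerre-suc-low : laguerre (suc i) a ≈ sgn (suc r) * (⟨ suc i C a ⟩ * ((1# + ⟨ i ⟩ + α) * φ i r))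
    laguerre-suc-low = trans (laguerre-at (suc i) a (ℕP.m≤n⇒m≤1+n a≤i) (ℕP.+-∸-assoc 1 a≤i))
                             (*-congˡ (*-congˡ (falling-step i r)))

    laguerre-low : laguerre i a ≈ - sgn (suc r) * (⟨ i C a ⟩ * φ i r)
    laguerre-low = trans (laguerre-at i a a≤i P.refl)
                         (*-congʳ (solve 1 (λ s → s := :- (:- :1 :* s)) refl (sgn r)))

    -- x is the binomial coefficient C(i, a - 1), or 0 when a = 0.
    shift-laguerre-low : Σ Carrier λ x →
      (⟨ suc i C a ⟩ ≈ x + ⟨ i C a ⟩) × (⟨ a ⟩ * ⟨ i C a ⟩ ≈ (1# + ⟨ r ⟩) * x)
      × (shift (laguerre i) a ≈ sgn (suc r) * (x * (φ i r * (⟨ a ⟩ + α))))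
    shift-laguerre-low = go a P.refl
      where
      go : ∀ a′ → a′ ≡ a → Σ Carrier λ x →
        (⟨ suc i C a ⟩ ≈ x + ⟨ i C a ⟩) × (⟨ a ⟩ * ⟨ i C a ⟩ ≈ (1# + ⟨ r ⟩) * x)
        × (shift (laguerre i) a ≈ sgn (suc r) * (x * (φ i r * (⟨ a ⟩ + α))))
      go zero    P.refl = 0# , sym (+-identityˡ _) , trans (zeroˡ _) (sym (zeroʳ _))
                        , sym (trans (*-congˡ (zeroˡ _)) (zeroʳ _))
      go (suc b) P.refl = ⟨ i C b ⟩
        , trans (⟨⟩-cong (P.sym (nCk+nC[k+1]≡[n+1]C[k+1] i b))) (⟨⟩-+ (i C b) (i C suc b))
        , trans (sym (⟨⟩-* (suc b) (i C suc b)))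
            (trans (⟨⟩-cong (P.sym (P.trans (P.cong (ℕ._* (i C b)) (P.sym i∸b))
                                             ([n∸k]*nCk≡[1+k]*nC[1+k] i b a≤i))))
                   (⟨⟩-* (suc r) (i C b)))
        , trans (laguerre-at i b (ℕP.<⇒≤ a≤i) i∸b) (*-congˡ (*-congˡ (*-congˡ i+α-r≈)))
        where
        i∸b : i ∸ b ≡ suc r
        i∸b = ℕP.+-∸-assoc 1 a≤i
        i+α-r≈ : ⟨ i ⟩ + α - ⟨ r ⟩ ≈ ⟨ suc b ⟩ + α
        i+α-r≈ = trans (+-congʳ (+-congʳ i≈a+r))
          (solve 3 (λ a r al → ((a :+ r) :+ al) :- r := a :+ al) refl ⟨ suc b ⟩ ⟨ r ⟩ α)

    laguerre-three-term-low :
      laguerre (suc i) a ≈ (shift (laguerre i) a - d i * laguerre i a) - e i * previous laguerre i a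
    laguerre-three-term-low = begin
      laguerre (suc i) a
        ≈⟨ laguerre-suc-low ⟩
      σ * (⟨ suc i C a ⟩ * ((1# + ⟨ i ⟩ + α) * φ i r))
        ≈⟨ three-term-identity σ (φ i r) ⟨ suc i C a ⟩ x ⟨ i C a ⟩ ⟨ a ⟩ ⟨ r ⟩ ⟨ i ⟩ i≈a+r pascal absorb ⟩
      (σ * (x * (φ i r * (⟨ a ⟩ + α))) - (((⟨ i ⟩ + ⟨ i ⟩) + 1#) + α) * (- σ * (⟨ i C a ⟩ * φ i r)))
        - σ * ((⟨ r ⟩ * ⟨ i C a ⟩) * φ i r)
        ≈⟨ +-cong (+-cong (sym shifted) (-‿cong (*-cong (sym (d≈ i)) (sym laguerre-low))))
                  (-‿cong (sym (e*previous-laguerre-low i a a≤i))) ⟩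
      (shift (laguerre i) a - d i * laguerre i a) - e i * previous laguerre i a ∎
      where
      σ = sgn (suc r)
      x = proj₁ shift-laguerre-low
      pascal = proj₁ (proj₂ shift-laguerre-low)
      absorb = proj₁ (proj₂ (proj₂ shift-laguerre-low))
      shifted = proj₂ (proj₂ (proj₂ shift-laguerre-low))

  previous-laguerre-high : ∀ i a → i < a → previous laguerre i a ≈ 0#
  previous-laguerre-high zero    a _   = refl
  previous-laguerre-high (suc i) a i<a = monicLaguerre-high i α a (ℕP.<-trans (ℕP.n<1+n i) i<a)

  laguerre-three-term : ∀ i → laguerre (suc i) ≋ shift (laguerre i) ⊖ d i ⋆ laguerre i ⊖ e i ⋆ previous laguerre i
  laguerre-three-term i a with a ℕ.≤? i
  ... | yes a≤i = laguerre-three-term-low i a a≤i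
  laguerre-three-term i zero    | no a≰i = ⊥-elim (a≰i z≤n)
  laguerre-three-term i (suc a) | no a≰i with ℕP.m≤n⇒m<n∨m≡n (ℕP.≰⇒> a≰i)
  ... | inj₂ P.refl = begin
    laguerre (suc a) (suc a)   ≈⟨ proj₁ laguerre-monic (suc a) ⟩
    1#                         ≈⟨ solve 2 (λ x y → :1 := (:1 :- x :* :0) :- y :* :0) refl (d a) (e a) ⟩
    (1# - d a * 0#) - e a * 0# ≈⟨ sym (+-cong (+-cong (proj₁ laguerre-monic a)
                                    (-‿cong (*-congˡ (proj₂ laguerre-monic a (suc a) ℕP.≤-refl))))
                                    (-‿cong (*-congˡ (previous-laguerre-high a (suc a) ℕP.≤-refl)))) ⟩
    (laguerre a a - d a * laguerre a (suc a)) - e a * previous laguerre a (suc a) ∎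
  ... | inj₁ (s≤s 1+i≤a) = begin
    laguerre (suc i) (suc a)   ≈⟨ proj₂ laguerre-monic (suc i) (suc a) (s≤s 1+i≤a) ⟩
    0#                         ≈⟨ solve 2 (λ x y → :0 := (:0 :- x :* :0) :- y :* :0) refl (d i) (e i) ⟩
    (0# - d i * 0#) - e i * 0# ≈⟨ sym (+-cong (+-cong (proj₂ laguerre-monic i a 1+i≤a)
                                    (-‿cong (*-congˡ (proj₂ laguerre-monic i (suc a) i<1+a))))
                                    (-‿cong (*-congˡ (previous-laguerre-high i (suc a) i<1+a)))) ⟩
    (laguerre i a - d i * laguerre i (suc a)) - e i * previous laguerre i (suc a) ∎
    where i<1+a = ℕP.m≤n⇒m≤1+n 1+i≤a

module ChangeOfBasis {c ℓ : Level} (R : CommutativeRing c ℓ) where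
  open CommutativeRing R hiding (zero)
  open RingArithmetic R
  open PowerSeries R
  open IndexedSums R
  open IndexedMatrices R
  open PolynomialFamilies R
  open PartialRootProducts R using (linearFactor)
  open ≋-Reasoning

  -- K and L are the transition matrices between two monic bases F and G of the
  -- polynomials of degree ≤ N, on which x acts by a three-term recurrence
  -- (F) and bidiagonally (G); F and G span the same space since F N = G N.
  module Expansions (N : ℕ) (F G : ℕ → Series) (F-monic : MonicFamily F) (G-monic : MonicFamily G)
    (d e ξ : ℕ → Carrier)
    (F-recurrence : ∀ i → F (suc i) ≋ shift (F i) ⊖ d i ⋆ F i ⊖ e i ⋆ previous F i)
    (G-recurrence : ∀ j → G (suc j) ≋ linearFactor (ξ j) (G j))
    (F≋G : F N ≋ G N) where

    private
      0+x*0-y*0-z*0≈0 : ∀ x y z → ((0# + x * 0#) - y * 0#) - z * 0# ≈ 0#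
      0+x*0-y*0-z*0≈0 = solve 3 (λ x y z → ((:0 :+ x :* :0) :- y :* :0) :- z :* :0 := :0) refl

      0+x*0+y*0-z*0≈0 : ∀ x y z → ((0# + x * 0#) + y * 0#) - z * 0# ≈ 0#
      0+x*0+y*0-z*0≈0 = solve 3 (λ x y z → ((:0 :+ x :* :0) :+ y :* :0) :- z :* :0 := :0) refl

    -- the next row of K, read off from x F i = Σⱼ Kᵢⱼ (G (j + 1) + ξⱼ G j)
    K-step : ℕ → Series → Series → Series
    K-step i A B = shift A ⊕ ξ ⊛ A ⊖ d i ⋆ A ⊖ e i ⋆ B

    K : ℕ → Series
    K zero          = δ 0
    K (suc zero)    = K-step 0 (δ 0) 𝟘
    K (suc (suc i)) = K-step (suc i) (K (suc i)) (K i)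

    K-suc : ∀ i → K (suc i) ≋ K-step i (K i) (previous K i)
    K-suc zero    = ≋-refl
    K-suc (suc i) = ≋-refl

    -- the next row of L, read off from x G j = Σᵢ Lⱼᵢ (F (i + 1) + dᵢ F i + eᵢ F (i - 1))
    L : ℕ → Series
    L zero    = δ 0
    L (suc j) = shift (L j) ⊕ d ⊛ L j ⊕ tail (e ⊛ L j) ⊖ ξ j ⋆ L j

    K-lower : ∀ i j → i < j → K i j ≈ 0#
    previous-K-lower : ∀ i j → i ≤ j → previous K i j ≈ 0#

    K-lower zero    (suc j) _         = δ-≢ {0} {suc j} (λ ())
    K-lower (suc i) (suc j) (s≤s i<j) = trans (K-suc i (suc j))
      (trans (+-cong (+-cong (+-cong (K-lower i j i<j) (*-congˡ (K-lower i (suc j) i<1+j)))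
                             (-‿cong (*-congˡ (K-lower i (suc j) i<1+j))))
                     (-‿cong (*-congˡ (previous-K-lower i (suc j) (ℕP.<⇒≤ i<1+j)))))
             (0+x*0-y*0-z*0≈0 _ _ _))
      where i<1+j = ℕP.m≤n⇒m≤1+n i<j

    previous-K-lower zero    j _       = refl
    previous-K-lower (suc i) j 1+i≤j   = K-lower i j 1+i≤j

    L-lower : ∀ i j → i < j → L i j ≈ 0#
    L-lower zero    (suc j) _         = δ-≢ {0} {suc j} (λ ())
    L-lower (suc i) (suc j) (s≤s i<j) = trans
      (+-cong (+-cong (+-cong (L-lower i j i<j) (*-congˡ (L-lower i (suc j) i<1+j)))
                      (*-congˡ (L-lower i (suc (suc j)) (ℕP.m≤n⇒m≤1+n i<1+j))))
              (-‿cong (*-congˡ (L-lower i (suc j) i<1+j))))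
      (0+x*0+y*0-z*0≈0 _ _ _)
      where i<1+j = ℕP.m≤n⇒m≤1+n i<j

    shift-G : ∀ j → shift (G j) ≋ G (suc j) ⊕ ξ j ⋆ G j
    shift-G j a = trans (solve 2 (λ x y → x := (x :- y) :+ y) refl _ _) (+-congʳ (sym (G-recurrence j a)))

    shift-F : ∀ i → shift (F i) ≋ F (suc i) ⊕ d i ⋆ F i ⊕ e i ⋆ previous F i
    shift-F i a = trans (solve 3 (λ s p q → s := ((s :- p) :- q) :+ p :+ q) refl _ _ _)
                        (+-congʳ (+-congʳ (sym (F-recurrence i a))))

    shift-lincomb-G : ∀ x → x N ≈ 0# → shift (lincomb (suc N) x G) ≋ lincomb (suc N) (shift x) G ⊕ lincomb (suc N) (ξ ⊛ x) G
    shift-lincomb-G x xₙ≈0 = begin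
      shift (lincomb (suc N) x G)                                      ≈⟨ shift-lincomb (suc N) x G ⟩
      lincomb (suc N) x (λ j → shift (G j))                            ≈⟨ lincomb-congᶠ (suc N) x (λ j _ → shift-G j) ⟩
      lincomb (suc N) x (λ j → G (suc j) ⊕ ξ j ⋆ G j)                  ≈⟨ lincomb-⊕ᶠ (suc N) x (λ j → G (suc j)) (λ j → ξ j ⋆ G j) ⟩
      lincomb (suc N) x (λ j → G (suc j)) ⊕ lincomb (suc N) x (λ j → ξ j ⋆ G j)
                                                                       ≈⟨ ⊕-cong (lincomb-suc N x G xₙ≈0)
                                                                                 (lincomb-⋆ᶠ (suc N) x ξ G) ⟩
      lincomb (suc N) (shift x) G ⊕ lincomb (suc N) (ξ ⊛ x) G          ∎

    shift-lincomb-F : ∀ y → y N ≈ 0# → y (suc N) ≈ 0# → shift (lincomb (suc N) y F)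
      ≋ lincomb (suc N) (shift y) F ⊕ lincomb (suc N) (d ⊛ y) F ⊕ lincomb (suc N) (tail (e ⊛ y)) F
    shift-lincomb-F y yₙ≈0 y₁₊ₙ≈0 = begin
      shift (lincomb (suc N) y F)                                      ≈⟨ shift-lincomb (suc N) y F ⟩
      lincomb (suc N) y (λ i → shift (F i))                            ≈⟨ lincomb-congᶠ (suc N) y (λ i _ → shift-F i) ⟩
      lincomb (suc N) y (λ i → F (suc i) ⊕ d i ⋆ F i ⊕ e i ⋆ previous F i)
                                                                       ≈⟨ ≋-trans (lincomb-⊕ᶠ (suc N) y (λ i → F (suc i) ⊕ d i ⋆ F i) (λ i → e i ⋆ previous F i))
                                                                            (⊕-cong (lincomb-⊕ᶠ (suc N) y (λ i → F (suc i)) (λ i → d i ⋆ F i)) ≋-refl) ⟩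
      lincomb (suc N) y (λ i → F (suc i)) ⊕ lincomb (suc N) y (λ i → d i ⋆ F i)
        ⊕ lincomb (suc N) y (λ i → e i ⋆ previous F i)                 ≈⟨ ⊕-cong (⊕-cong (lincomb-suc N y F yₙ≈0)
                                                                                          (lincomb-⋆ᶠ (suc N) y d F))
                                                                                 (≋-trans (lincomb-⋆ᶠ (suc N) y e (previous F))
                                                                                    (lincomb-previous N (e ⊛ y) F
                                                                                       (trans (*-congˡ y₁₊ₙ≈0) (zeroʳ _)))) ⟩
      lincomb (suc N) (shift y) F ⊕ lincomb (suc N) (d ⊛ y) F ⊕ lincomb (suc N) (tail (e ⊛ y)) F ∎

    private
      lincomb-K-step : ∀ i x y → lincomb (suc N) (K-step i x y) G
        ≋ lincomb (suc N) (shift x) G ⊕ lincomb (suc N) (ξ ⊛ x) G ⊖ d i ⋆ lincomb (suc N) x G ⊖ e i ⋆ lincomb (suc N) y G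
      lincomb-K-step i x y = ≋-trans (lincomb-⊖ (suc N) (shift x ⊕ ξ ⊛ x ⊖ d i ⋆ x) (e i ⋆ y) G)
        (⊖-cong (≋-trans (lincomb-⊖ (suc N) (shift x ⊕ ξ ⊛ x) (d i ⋆ x) G)
                         (⊖-cong (lincomb-⊕ (suc N) (shift x) (ξ ⊛ x) G) (lincomb-⋆ (suc N) (d i) x G)))
                (lincomb-⋆ (suc N) (e i) y G))

      lincomb-L-suc : ∀ j → lincomb (suc N) (L (suc j)) F
        ≋ lincomb (suc N) (shift (L j)) F ⊕ lincomb (suc N) (d ⊛ L j) F ⊕ lincomb (suc N) (tail (e ⊛ L j)) F
          ⊖ ξ j ⋆ lincomb (suc N) (L j) F
      lincomb-L-suc j = ≋-trans (lincomb-⊖ (suc N) (shift (L j) ⊕ d ⊛ L j ⊕ tail (e ⊛ L j)) (ξ j ⋆ L j) F)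
        (⊖-cong (≋-trans (lincomb-⊕ (suc N) (shift (L j) ⊕ d ⊛ L j) (tail (e ⊛ L j)) F)
                         (⊕-cong (lincomb-⊕ (suc N) (shift (L j)) (d ⊛ L j) F) ≋-refl))
                (lincomb-⋆ (suc N) (ξ j) (L j) F))

    F≋K : ∀ i → i ≤ N → F i ≋ lincomb (suc N) (K i) G
    previous-F≋K : ∀ i → i ≤ N → previous F i ≋ lincomb (suc N) (previous K i) G

    F≋K zero _ = ≋-trans (monic-zero F F-monic)
      (≋-trans (≋-sym (monic-zero G G-monic)) (≋-sym (lincomb-δ (suc N) G 0 (s≤s z≤n))))
    F≋K (suc i) i<N = begin
      F (suc i)                                                  ≈⟨ F-recurrence i ⟩
      shift (F i) ⊖ d i ⋆ F i ⊖ e i ⋆ previous F i              ≈⟨ ⊖-cong (⊖-cong (shift-cong Fᵢ≋) (⋆-cong (d i) Fᵢ≋))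
                                                                           (⋆-cong (e i) (previous-F≋K i i≤N)) ⟩
      shift Kᵢ·G ⊖ d i ⋆ Kᵢ·G ⊖ e i ⋆ lincomb (suc N) (previous K i) G
                                                                 ≈⟨ ⊖-cong (⊖-cong (shift-lincomb-G (K i) (K-lower i N i<N))
                                                                                   ≋-refl) ≋-refl ⟩
      lincomb (suc N) (shift (K i)) G ⊕ lincomb (suc N) (ξ ⊛ K i) G ⊖ d i ⋆ Kᵢ·G
        ⊖ e i ⋆ lincomb (suc N) (previous K i) G                 ≈⟨ ≋-sym (lincomb-K-step i (K i) (previous K i)) ⟩
      lincomb (suc N) (K-step i (K i) (previous K i)) G          ≈⟨ lincomb-cong (suc N) G (λ l _ → sym (K-suc i l)) ⟩
      lincomb (suc N) (K (suc i)) G                              ∎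
      where
      i≤N = ℕP.<⇒≤ i<N
      Kᵢ·G = lincomb (suc N) (K i) G
      Fᵢ≋ = F≋K i i≤N

    previous-F≋K zero    _     = ≋-sym (lincomb-𝟘 (suc N) G)
    previous-F≋K (suc i) 1+i≤N = F≋K i (ℕP.<⇒≤ 1+i≤N)

    G≋L : ∀ j → j ≤ N → G j ≋ lincomb (suc N) (L j) F
    G≋L zero _ = ≋-trans (monic-zero G G-monic)
      (≋-trans (≋-sym (monic-zero F F-monic)) (≋-sym (lincomb-δ (suc N) F 0 (s≤s z≤n))))
    G≋L (suc j) j<N = begin
      G (suc j)                                                  ≈⟨ G-recurrence j ⟩
      shift (G j) ⊖ ξ j ⋆ G j                                    ≈⟨ ⊖-cong (shift-cong Gⱼ≋) (⋆-cong (ξ j) Gⱼ≋) ⟩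
      shift Lⱼ·F ⊖ ξ j ⋆ Lⱼ·F                                   ≈⟨ ⊖-cong (shift-lincomb-F (L j) (L-lower j N j<N)
                                                                             (L-lower j (suc N) (ℕP.m≤n⇒m≤1+n j<N))) ≋-refl ⟩
      lincomb (suc N) (shift (L j)) F ⊕ lincomb (suc N) (d ⊛ L j) F ⊕ lincomb (suc N) (tail (e ⊛ L j)) F
        ⊖ ξ j ⋆ Lⱼ·F                                             ≈⟨ ≋-sym (lincomb-L-suc j) ⟩
      lincomb (suc N) (L (suc j)) F                              ∎
      where
      Lⱼ·F = lincomb (suc N) (L j) F
      Gⱼ≋ = G≋L j (ℕP.<⇒≤ j<N)

    open Square N using (_≐_; _·_)

    K-last : ∀ j → j < N → K N j ≈ 0#
    K-last j j<N = trans (K≈δ j (ℕP.m≤n⇒m≤1+n j<N)) (δ-≢ (λ N≡j → ℕP.<-irrefl (P.sym N≡j) j<N))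
      where
      K≈δ = lincomb-injective G G-monic (suc N) (K N) (δ N)
        (≋-trans (≋-sym (F≋K N ℕP.≤-refl)) (≋-trans F≋G (≋-sym (lincomb-δ (suc N) G N ℕP.≤-refl))))

    K·L≐δ : K · L ≐ δ
    K·L≐δ i l i<N l<N = trans
      (sym (∑-last-vanishing N _ (trans (*-congʳ (K-lower i N i<N)) (zeroˡ _))))
      (lincomb-injective F F-monic (suc N) (λ l → ∑ (suc N) (λ j → K i j * L j l)) (δ i)
        (λ a → trans (sym (lincomb-compose (suc N) (K i) L G F (λ j j≤N → G≋L j (ℕP.≤-pred j≤N)) a))
                     (trans (sym (F≋K i (ℕP.<⇒≤ i<N) a)) (sym (lincomb-δ (suc N) F i (ℕP.m≤n⇒m≤1+n i<N) a))))
        l (ℕP.m≤n⇒m≤1+n l<N))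

    L·K≐δ : L · K ≐ δ
    L·K≐δ j l j<N l<N = trans
      (sym (∑-last-vanishing N _ (trans (*-congʳ (L-lower j N j<N)) (zeroˡ _))))
      (lincomb-injective G G-monic (suc N) (λ l → ∑ (suc N) (λ i → L j i * K i l)) (δ j)
        (λ a → trans (sym (lincomb-compose (suc N) (L j) K F G (λ i i≤N → F≋K i (ℕP.≤-pred i≤N)) a))
                     (trans (sym (G≋L j (ℕP.<⇒≤ j<N) a)) (sym (lincomb-δ (suc N) G j (ℕP.m≤n⇒m≤1+n j<N) a))))
        l (ℕP.m≤n⇒m≤1+n l<N))

module LaguerreMatrix {c ℓ : Level} (R : CommutativeRing c ℓ)
  (m : ℕ) (α : CommutativeRing.Carrier R) (ξ : Fin m → CommutativeRing.Carrier R)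
  (roots : ∀ j → CommutativeRing._≈_ R (rootPoly R m ξ j) (monicLaguerre R m α j)) where
  import Data.Fin.Properties as FinP
  open CommutativeRing R hiding (zero)
  open RingArithmetic R
  open PowerSeries R
  open IndexedSums R
  open IndexedMatrices R
  open Square m
  open PartialRootProducts R
  open PolynomialFamilies R using (previous)
  open LaguerreThreeTerm R α
  open Conditional
  open import Relation.Binary.Reasoning.Setoid setoid

  ξℕ : ℕ → Carrier
  ξℕ l with l ℕ.<? m
  ... | yes l<m = ξ (fromℕ< l<m)
  ... | no _    = 0#

  ξℕ-toℕ : ∀ i → ξℕ (toℕ i) ≈ ξ i
  ξℕ-toℕ i with toℕ i ℕ.<? m
  ... | yes i<m = reflexive (P.cong ξ (FinP.fromℕ<-toℕ i i<m))
  ... | no i≮m  = ⊥-elim (i≮m (FinP.toℕ<n i))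

  laguerre≋partialProduct : laguerre m ≋ partialProduct ξℕ m
  laguerre≋partialProduct a = trans (sym (roots a)) (sym (rootPoly-cong m ξℕ-toℕ a))

  open ChangeOfBasis.Expansions R m laguerre (partialProduct ξℕ) laguerre-monic (partialProduct-monic ξℕ)
    d e ξℕ laguerre-three-term (partialProduct-suc ξℕ) laguerre≋partialProduct

  Tℕ : Matrix
  Tℕ i j = if does (i ℕ.≟ j) then ⟨ 2 ℕ.* i ℕ.+ 1 ⟩ + α
    else if does (suc i ℕ.≟ j) then 1#
    else if does (i ℕ.≟ suc j) then ⟨ suc j ⟩ * (⟨ suc j ⟩ + α)
    else 0#

  -- the matrix of multiplication by x in the basis of partial products
  Cℕ : Matrix
  Cℕ i j = if does (i ℕ.≟ j) then ξℕ i else if does (suc i ℕ.≟ j) then 1# else 0#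

  private
    n≢1+n : ∀ n → n ≢ suc n
    n≢1+n n n≡1+n = ℕP.<-irrefl n≡1+n (ℕP.n<1+n n)

    n≢2+n : ∀ n → n ≢ suc (suc n)
    n≢2+n n n≡2+n = ℕP.<-irrefl n≡2+n (ℕP.<-trans (ℕP.n<1+n n) (ℕP.n<1+n (suc n)))

  T-decomposition : ∀ i l → Tℕ i l ≈ (δ i l * d i + δ (suc i) l) + δ i (suc l) * e i
  T-decomposition i l with i ℕ.≟ l
  ... | yes P.refl = trans (reflexive (if-yes (i ℕ.≟ i) P.refl)) (sym (trans
    (+-cong (+-cong (*-congʳ (δ-refl i)) (δ-≢ (λ 1+i≡i → n≢1+n i (P.sym 1+i≡i)))) (*-congʳ (δ-≢ (n≢1+n i))))
    (solve 2 (λ x y → (:1 :* x :+ :0) :+ :0 :* y := x) refl _ _)))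
  ... | no i≢l with suc i ℕ.≟ l
  ...   | yes P.refl = trans (reflexive (P.trans (if-no (i ℕ.≟ suc i) i≢l) (if-yes (suc i ℕ.≟ suc i) P.refl)))
    (sym (trans (+-cong (+-cong (*-congʳ (δ-≢ (n≢1+n i))) (δ-refl (suc i))) (*-congʳ (δ-≢ (n≢2+n i))))
                (solve 2 (λ x y → (:0 :* x :+ :1) :+ :0 :* y := :1) refl _ _)))
  ...   | no 1+i≢l with i ℕ.≟ suc l
  ...     | yes P.refl = trans (reflexive (P.trans (if-no (suc l ℕ.≟ l) i≢l)
                                          (P.trans (if-no (suc (suc l) ℕ.≟ l) 1+i≢l) (if-yes (suc l ℕ.≟ suc l) P.refl))))
    (sym (trans (+-cong (+-cong (*-congʳ (δ-≢ i≢l)) (δ-≢ 1+i≢l)) (*-congʳ (δ-refl (suc l))))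
                (solve 2 (λ x y → (:0 :* x :+ :0) :+ :1 :* y := y) refl _ _)))
  ...     | no i≢1+l = trans (reflexive (P.trans (if-no (i ℕ.≟ l) i≢l)
                                        (P.trans (if-no (suc i ℕ.≟ l) 1+i≢l) (if-no (i ℕ.≟ suc l) i≢1+l))))
    (sym (trans (+-cong (+-cong (*-congʳ (δ-≢ i≢l)) (δ-≢ 1+i≢l)) (*-congʳ (δ-≢ i≢1+l)))
                (solve 2 (λ x y → (:0 :* x :+ :0) :+ :0 :* y := :0) refl _ _)))

  C-decomposition : ∀ l j → Cℕ l j ≈ δ l j * ξℕ j + δ (suc l) j
  C-decomposition l j with l ℕ.≟ j
  ... | yes P.refl = trans (reflexive (if-yes (l ℕ.≟ l) P.refl))
    (sym (trans (+-cong (*-congʳ (δ-refl l)) (δ-≢ (λ 1+l≡l → n≢1+n l (P.sym 1+l≡l))))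
                (solve 1 (λ x → :1 :* x :+ :0 := x) refl _)))
  ... | no l≢j with suc l ℕ.≟ j
  ...   | yes P.refl = trans (reflexive (P.trans (if-no (l ℕ.≟ suc l) l≢j) (if-yes (suc l ℕ.≟ suc l) P.refl)))
    (sym (trans (+-cong (*-congʳ (δ-≢ (n≢1+n l))) (δ-refl (suc l)))
                (solve 1 (λ x → :0 :* x :+ :1 := :1) refl _)))
  ...   | no 1+l≢j = trans (reflexive (P.trans (if-no (l ℕ.≟ j) l≢j) (if-no (suc l ℕ.≟ j) 1+l≢j)))
    (sym (trans (+-cong (*-congʳ (δ-≢ l≢j)) (δ-≢ 1+l≢j))
                (solve 1 (λ x → :0 :* x :+ :0 := :0) refl _)))

  C-upper : UpperTriangular Cℕ
  C-upper i l l<i = trans (C-decomposition i l)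
    (trans (+-cong (*-congʳ (δ-upper i l l<i)) (δ-upper (suc i) l (ℕP.m<n⇒m<1+n l<i)))
           (solve 1 (λ x → :0 :* x :+ :0 := :0) refl _))

  private
    column-shift : ∀ k j i → shift (λ l → k * K l j) i ≈ k * previous K i j
    column-shift k j zero    = sym (zeroʳ k)
    column-shift k j (suc i) = refl

  T·K-row : ∀ i j → i < m → j < m → (Tℕ · K) i j ≈ (d i * K i j + K (suc i) j) + e i * previous K i j
  T·K-row i j i<m j<m = begin
    ∑ m (λ l → Tℕ i l * K l j)
      ≈⟨ ∑-cong m (λ l _ → trans (*-congʳ (T-decomposition i l))
           (solve 6 (λ a x b y k z → ((a :* x :+ b) :+ y :* k) :* z := (a :* (x :* z) :+ b :* z) :+ y :* (k :* z))
              refl (δ i l) (d i) (δ (suc i) l) (δ i (suc l)) (e i) (K l j))) ⟩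
    ∑ m (λ l → (δ i l * (d i * K l j) + δ (suc i) l * K l j) + δ i (suc l) * (e i * K l j))
      ≈⟨ trans (∑-+ m _ _) (+-congʳ (∑-+ m _ _)) ⟩
    (∑ m (λ l → δ i l * (d i * K l j)) + ∑ m (λ l → δ (suc i) l * K l j)) + ∑ m (λ l → δ i (suc l) * (e i * K l j))
      ≈⟨ +-cong (+-cong (∑-δˡ m i (λ l → d i * K l j) i<m) next-row)
                (trans (∑-δˡ-suc m i (λ l → e i * K l j) (ℕP.<⇒≤ i<m)) (column-shift (e i) j i)) ⟩
    (d i * K i j + K (suc i) j) + e i * previous K i j ∎
    where
    next-row : ∑ m (λ l → δ (suc i) l * K l j) ≈ K (suc i) j
    next-row with ℕP.m≤n⇒m<n∨m≡n i<m
    ... | inj₁ 1+i<m   = ∑-δˡ m (suc i) (λ l → K l j) 1+i<m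
    ... | inj₂ P.refl  = trans (∑-δˡ-beyond m m (λ l → K l j) ℕP.≤-refl) (sym (K-last j j<m))

  K·C-row : ∀ i j → j < m → (K · Cℕ) i j ≈ K i j * ξℕ j + shift (K i) j
  K·C-row i j j<m = begin
    ∑ m (λ l → K i l * Cℕ l j)
      ≈⟨ ∑-cong m (λ l _ → trans (*-congˡ (C-decomposition l j))
           (solve 4 (λ k a x b → k :* (a :* x :+ b) := a :* (k :* x) :+ b :* k) refl (K i l) (δ l j) (ξℕ j) (δ (suc l) j))) ⟩
    ∑ m (λ l → δ l j * (K i l * ξℕ j) + δ (suc l) j * K i l)
      ≈⟨ ∑-+ m _ _ ⟩
    ∑ m (λ l → δ l j * (K i l * ξℕ j)) + ∑ m (λ l → δ (suc l) j * K i l)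
      ≈⟨ +-cong (∑-δʳ m j (λ l → K i l * ξℕ j) j<m) (∑-δʳ-suc m j (K i) (ℕP.<⇒≤ j<m)) ⟩
    K i j * ξℕ j + shift (K i) j ∎

  T·K≐K·C : Tℕ · K ≐ K · Cℕ
  T·K≐K·C i j i<m j<m = begin
    (Tℕ · K) i j                                      ≈⟨ T·K-row i j i<m j<m ⟩
    (d i * K i j + K (suc i) j) + e i * previous K i j ≈⟨ +-congʳ (+-congˡ (K-suc i j)) ⟩
    (d i * K i j + (((shift (K i) j + ξℕ j * K i j) - d i * K i j) - e i * previous K i j)) + e i * previous K i j
      ≈⟨ solve 6 (λ dd k s x ee p → (dd :* k :+ (((s :+ x :* k) :- dd :* k) :- ee :* p)) :+ ee :* p := k :* x :+ s)
           refl (d i) (K i j) (shift (K i) j) (ξℕ j) (e i) (previous K i j) ⟩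
    K i j * ξℕ j + shift (K i) j                      ≈⟨ sym (K·C-row i j j<m) ⟩
    (K · Cℕ) i j                                      ∎

  C-diagonal : ∀ j → Cℕ j j ≈ ξℕ j
  C-diagonal j = reflexive (if-yes (j ℕ.≟ j) P.refl)

  trace-T^k : ∀ k → trace R m (powMat R m (Tmat R α m) k) ≈ sumFin R m (λ i → powR R (ξ i) k)
  trace-T^k k = begin
    trace R m (powMat R m (Tmat R α m) k)        ≈⟨ trace-powMat≈tr (Tmat R α m) Tℕ (λ i j → refl) k ⟩
    tr (Tℕ ^ k)                                  ≈⟨ tr-^-similar Tℕ Cℕ K L K·L≐δ L·K≐δ T·K≐K·C k ⟩
    tr (Cℕ ^ k)                                  ≈⟨ ∑-cong m (λ j j<m → trans (^-upper-diagonal Cℕ C-upper k j j<m)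
                                                                               (powR-cong k (C-diagonal j))) ⟩
    ∑ m (λ j → powR R (ξℕ j) k)                  ≈⟨ sym (sumFin≈∑ m (λ j → powR R (ξℕ j) k)) ⟩
    sumFin R m (λ i → powR R (ξℕ (toℕ i)) k)     ≈⟨ FinSums.sumFin-cong R m (λ i → powR-cong k (ξℕ-toℕ i)) ⟩
    sumFin R m (λ i → powR R (ξ i) k)            ∎

mainTheorem10 : {c ℓ : Level} (R : CommutativeRing c ℓ) →
    let open CommutativeRing R in
    (α : Carrier) (m : ℕ) → 1 ≤ m →
    (ξ : Fin m → Carrier) →
    (∀ j → rootPoly R m ξ j ≈ monicLaguerre R m α j) →
    (n : ℕ) → 1 ≤ n →
    (natR R m * u R α m n ≈ sumFin R m (λ i → powR R (ξ i) (n ∸ 1)))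
    × (natR R m * u R α m n ≈ trace R m (powMat R m (Tmat R α m) (n ∸ 1)))
mainTheorem10 R α m _ ξ roots (suc n) _ = m*u≈powerSum , trans m*u≈powerSum (sym (trace-T^k n))
  where
  open CommutativeRing R
  open NewtonIdentities R
  open ReciprocalLaguerre R m α ξ roots
  open Riccati R
  open LaguerreMatrix R m α ξ roots using (trace-T^k)
  Q = reciprocal m ξ
  P = powerSum m ξ
  m*u≈powerSum : natR R m * u R α m (suc n) ≈ P n
  m*u≈powerSum = SequenceU.m*u≈riccati R α m P
    (riccati-constant (natR R m) α Q P reciprocal-constant (newton m ξ) reciprocal-recurrence)
    (riccati-recurrence (natR R m) α Q P reciprocal-constant (newton m ξ) reciprocal-recurrence) n
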